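{- Let $\chi$ be a natural number and $m\ge1$ an integer. Then, as formal power series in $u$, \[ \sum_{n=0}^{\infty} \frac{u^n}{n!} \sum_{(\pi_1,\ldots,\pi_m) \in \mathrm{Com}(S_{n},m)} \chi ^{\#(\pi_1,\ldots,\pi_m)} = \left( \sum_{n=0}^{\infty} \frac{u^n\, |\mathrm{Com}(S_n,m)|}{n!} \right) ^{\chi}. \]
   Context: $\mathrm{Com}(S_n,m)$ is the set of ordered $m$-tuples of mutually commuting elements of the symmetric group $S_n$ (with $S_0$ trivial, so $|\mathrm{Com}(S_0,m)|=1$). For $(\pi_1,\ldots,\pi_m)\in\mathrm{Com}(S_n,m)$, $\#(\pi_1,\ldots,\pi_m)$ is the number of connected components of the graph on vertex set $\{1,\ldots,n\}$ in which $x$ is joined to $\pi_k(x)$ for every $x$ and every $k$. -}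

module Defs where

open import Data.Nat using (ℕ; zero; suc; _+_; _*_; _^_; _!; _<ᵇ_)
open import Data.Nat.Properties using (_!≢0)
open import Data.Bool using (Bool; true; false; _∧_; _∨_; not; if_then_else_)
open import Data.Fin using (Fin; toℕ; _≟_)
open import Data.List using (List; []; _∷_; map; concatMap; filter; length; foldr; allFin; upTo)
import Data.List as List
open import Data.Vec using (Vec; []; _∷_; lookup)
import Data.Vec as Vec
open import Data.Integer using (+_)
open import Data.Rational using (ℚ; _/_) renaming (_+_ to _+ℚ_; _*_ to _*ℚ_; 0ℚ to 0ℚ; 1ℚ to 1ℚ)
open import Relation.Nullary.Decidable using (⌊_⌋)

allB : ∀ {A : Set} → (A → Bool) → List A → Bool
allB p = foldr (λ a b → p a ∧ b) true

anyB : ∀ {A : Set} → (A → Bool) → List A → Bool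
anyB p = foldr (λ a b → p a ∨ b) false

_==_ : ∀ {n} → Fin n → Fin n → Bool
x == y = ⌊ x ≟ y ⌋

Map : ℕ → Set
Map n = Vec (Fin n) n

app : ∀ {n} → Map n → Fin n → Fin n
app f x = lookup f x

allVecs : (n k : ℕ) → List (Vec (Fin n) k)
allVecs n zero    = [] ∷ []
allVecs n (suc k) = concatMap (λ x → map (x ∷_) (allVecs n k)) (allFin n)

-- a map Fin n → Fin n is a permutation (element of S_n) iff it is injective
isPermB : ∀ {n} → Map n → Bool
isPermB {n} f =
  allB (λ x → allB (λ y → not (app f x == app f y) ∨ (x == y)) (allFin n)) (allFin n)

commB : ∀ {n} → Map n → Map n → Bool
commB {n} f g = allB (λ x → app f (app g x) == app g (app f x)) (allFin n)

Tuple : ℕ → ℕ → Set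
Tuple n m = Vec (Map n) m

allTuples : (n m : ℕ) → List (Tuple n m)
allTuples n m = allVecs' m
  where
  allVecs' : (k : ℕ) → List (Vec (Map n) k)
  allVecs' zero    = [] ∷ []
  allVecs' (suc k) = concatMap (λ f → map (f ∷_) (allVecs' k)) (allVecs n n)

isComB : ∀ {n m} → Tuple n m → Bool
isComB {n} {m} t =
  allB isPermB (Vec.toList t) ∧
  allB (λ f → allB (λ g → commB f g) (Vec.toList t)) (Vec.toList t)

Com : (n m : ℕ) → List (Tuple n m)
Com n m = filter (λ t → isComB t Data.Bool.≟ true) (allTuples n m)

-- Number of connected components #(π₁,…,πₘ) of the graph on {1..n}
-- with edges x — πₖ(x).

adjB : ∀ {n m} → Tuple n m → Fin n → Fin n → Bool
adjB t x y = anyB (λ f → (app f x == y) ∨ (app f y == x)) (Vec.toList t)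

walkB : ∀ {n m} → Tuple n m → ℕ → Fin n → Fin n → Bool
walkB t zero    x y = x == y
walkB {n} t (suc k) x y =
  walkB t k x y ∨ anyB (λ z → adjB t x z ∧ walkB t k z y) (allFin n)

-- x and y lie in the same connected component
-- (a walk exists iff one of length ≤ n exists)
connB : ∀ {n m} → Tuple n m → Fin n → Fin n → Bool
connB {n} t x y = walkB t n x y

-- number of components = number of vertices that are the least element
-- of their component
ncomp : ∀ {n m} → Tuple n m → ℕ
ncomp {n} t =
  length (filter (λ x → not (anyB (λ y → (toℕ y <ᵇ toℕ x) ∧ connB t x y) (allFin n))
                         Data.Bool.≟ true)
                 (allFin n))

FPS : Set
FPS = ℕ → ℚ

sumℚ : List ℚ → ℚ
sumℚ = foldr _+ℚ_ 0ℚ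

oneS : FPS
oneS zero    = 1ℚ
oneS (suc _) = 0ℚ

_⊛_ : FPS → FPS → FPS
(f ⊛ g) n = sumℚ (map (λ i → f i *ℚ g (n Data.Nat.∸ i)) (upTo (suc n)))

powS : FPS → ℕ → FPS
powS f zero    = oneS
powS f (suc k) = f ⊛ powS f k

ℕtoℚ : ℕ → ℚ
ℕtoℚ a = (+ a) / 1

divFact : ℕ → ℕ → ℚ
divFact a n = (+ a) / (n !) where instance _ = n !≢0

sumℕ : List ℕ → ℕ
sumℕ = foldr _+_ 0

lhsSeries : ℕ → ℕ → FPS
lhsSeries χ m n = divFact (sumℕ (map (λ t → χ ^ ncomp t) (Com n m))) n

comSeries : ℕ → FPS
comSeries m n = divFact (length (Com n m)) n

-- For t ∈ Com(Sₙ,m), χ^#(t) counts the colourings of {1,…,n} by χ colours that are invariant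
-- under t, i.e. constant on its components: such a colouring is determined by its arbitrary values
-- at the least elements of the components. Let W_χ(n) be the sum of these counts over Com(Sₙ,m)
-- and C(n) = |Com(Sₙ,m)|. If c is a t-invariant colouring by χ+1 colours, the set S of points of
-- colour 0 is preserved by t; restricting t to S and to its complement, and c to the complement,
-- is a bijection onto pairs of commuting tuples on S and on its complement together with a
-- χ-colouring of the complement invariant under the latter. Summing over S gives
-- W_{χ+1}(n) = Σₖ (n choose k) C(k) W_χ(n−k), which after division by n! says that the exponential
-- generating function of W_{χ+1} is that of C times that of W_χ, while that of W_0 is 1.

module Submission where

open import Defs
open import Data.Nat using (ℕ; _≤_)
open import Relation.Binary.PropositionalEquality using (_≡_)

open import Algebra.Properties.CommutativeSemigroup using (interchange)
open import Data.Bool using (Bool; true; false; T; _∧_; _∨_; not; if_then_else_)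
import Data.Bool.Properties as Bool
open import Data.Empty using (⊥-elim)
open import Data.Fin using (Fin; zero; suc; toℕ; punchOut)
import Data.Fin.Properties as Fin
open import Data.Fin.Subset using (Subset; inside; outside; ∣_∣; ∁)
open import Data.Fin.Subset.Properties using (∣p∣≤n; ∣∁p∣≡n∸∣p∣)
import Data.Integer as ℤ
import Data.Integer.Properties as ℤ
open import Data.List
  using (List; []; _∷_; _++_; map; concatMap; filter; length; allFin; upTo; cartesianProduct; cartesianProductWith)
import Data.List.Properties as List
open import Data.List.Membership.Propositional using (_∈_)
open import Data.List.Membership.Propositional.Properties using (∈-allFin; ∈-upTo⁻)
import Data.List.Relation.Unary.All as All
open import Data.List.Relation.Unary.Any using (here; there)
import Data.Nat as ℕ
open import Data.Nat using (zero; suc; pred; _+_; _*_; _^_; _∸_; _<_; _<?_; _<ᵇ_; _!; z≤n; s≤s)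
open import Data.Nat.Combinatorics using (_C_; nCk+nC[k+1]≡[n+1]C[k+1]; nCk≡n!/k![n-k]!; k![n∸k]!∣n!)
open import Data.Nat.DivMod using (m/n*n≡m)
open import Data.Nat.Properties hiding (_≟_)
open import Data.Nat.Tactic.RingSolver using (solve-∀)
open import Data.Product using (Σ-syntax; ∃-syntax; _×_; _,_; proj₁; proj₂)
import Data.Product.Properties as Product
open import Data.Rational using (toℚᵘ; 0ℚ) renaming (_+_ to _+ℚ_; _*_ to _*ℚ_)
import Data.Rational.Properties as ℚ
open import Data.Rational.Unnormalised using (ℚᵘ; mkℚᵘ; *≡*) renaming (_≃_ to _≃ᵘ_; _+_ to _+ᵘ_; _*_ to _*ᵘ_)
import Data.Rational.Unnormalised.Properties as ℚᵘ
open import Data.Sum using (_⊎_; inj₁; inj₂)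
import Data.Sum as Sum
import Data.Sum.Properties as Sum
open import Data.Vec using (Vec; []; _∷_; lookup)
import Data.Vec as Vec
import Data.Vec.Properties as Vec
open import Data.Vec.Membership.Propositional.Properties using (∈-lookup; ∈-toList⁺)
open import Function using (id; _∘_; Equivalence; mk⇔)
open import Function.Definitions using (Injective)
open import Relation.Binary.Construct.Closure.ReflexiveTransitive using (Star; ε; _◅_; _◅◅_)
import Relation.Binary.Construct.Closure.ReflexiveTransitive as Star
open import Relation.Binary.Definitions using (DecidableEquality; Tri; tri<; tri≈; tri>)
open import Relation.Binary.PropositionalEquality
  using (_≢_; refl; sym; trans; cong; cong₂; subst; subst₂; _≗_; module ≡-Reasoning)
open import Relation.Nullary using (Dec; yes; no; does; ¬_; contradiction)
open import Relation.Nullary.Decidable using (dec-true; dec-false; does-⇔; toWitness; fromWitness)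
open import Relation.Nullary.Decidable.Core using (T?; _×-dec_; _⊎-dec_)

private
  variable
    A B D : Set

𝟙 : Bool → ℕ
𝟙 true  = 1
𝟙 false = 0

𝟙-∧ : ∀ a b → 𝟙 (a ∧ b) ≡ 𝟙 a * 𝟙 b
𝟙-∧ true  b = sym (+-identityʳ (𝟙 b))
𝟙-∧ false b = refl

𝟙≤1 : ∀ b → 𝟙 b ≤ 1
𝟙≤1 true  = ≤-refl
𝟙≤1 false = z≤n

T⇒𝟙≡1 : ∀ {b} → T b → 𝟙 b ≡ 1
T⇒𝟙≡1 {true} _ = refl

¬T⇒𝟙≡0 : ∀ {b} → ¬ T b → 𝟙 b ≡ 0
¬T⇒𝟙≡0 {true}  ¬b = ⊥-elim (¬b _)
¬T⇒𝟙≡0 {false} _  = refl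

∑ : List A → (A → ℕ) → ℕ
∑ xs f = sumℕ (map f xs)

infix 5 ∑
syntax ∑ xs (λ x → e) = ∑[ x ∈ xs ] e

∑-cong : ∀ {f g : A → ℕ} → f ≗ g → ∀ xs → ∑ xs f ≡ ∑ xs g
∑-cong f≗g []       = refl
∑-cong f≗g (x ∷ xs) = cong₂ _+_ (f≗g x) (∑-cong f≗g xs)

∑-zero : ∀ {f : A → ℕ} → (∀ x → f x ≡ 0) → ∀ xs → ∑ xs f ≡ 0
∑-zero f≡0 []       = refl
∑-zero f≡0 (x ∷ xs) = cong₂ _+_ (f≡0 x) (∑-zero f≡0 xs)

∑-+ : ∀ (f g : A → ℕ) xs → ∑[ x ∈ xs ] (f x + g x) ≡ ∑ xs f + ∑ xs g
∑-+ f g []       = refl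
∑-+ f g (x ∷ xs) = trans (cong (f x + g x +_) (∑-+ f g xs))
                         (interchange +-commutativeSemigroup (f x) (g x) (∑ xs f) (∑ xs g))

∑-*ˡ : ∀ k (f : A → ℕ) xs → ∑[ x ∈ xs ] k * f x ≡ k * ∑ xs f
∑-*ˡ k f []       = sym (*-zeroʳ k)
∑-*ˡ k f (x ∷ xs) = trans (cong (k * f x +_) (∑-*ˡ k f xs)) (sym (*-distribˡ-+ k (f x) (∑ xs f)))

∑-*ʳ : ∀ k (f : A → ℕ) xs → ∑[ x ∈ xs ] f x * k ≡ ∑ xs f * k
∑-*ʳ k f xs = trans (∑-cong (λ x → *-comm (f x) k) xs) (trans (∑-*ˡ k f xs) (*-comm k (∑ xs f)))

∑-mono-≤ : ∀ {f g : A → ℕ} → (∀ x → f x ≤ g x) → ∀ xs → ∑ xs f ≤ ∑ xs g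
∑-mono-≤ f≤g []       = z≤n
∑-mono-≤ f≤g (x ∷ xs) = +-mono-≤ (f≤g x) (∑-mono-≤ f≤g xs)

∑-++ : ∀ (f : A → ℕ) xs ys → ∑ (xs ++ ys) f ≡ ∑ xs f + ∑ ys f
∑-++ f []       ys = refl
∑-++ f (x ∷ xs) ys = trans (cong (f x +_) (∑-++ f xs ys)) (sym (+-assoc (f x) (∑ xs f) (∑ ys f)))

∑-map : ∀ (f : B → ℕ) (g : A → B) xs → ∑ (map g xs) f ≡ ∑ xs (f ∘ g)
∑-map f g []       = refl
∑-map f g (x ∷ xs) = cong (f (g x) +_) (∑-map f g xs)

∑-cartesianProductWith : ∀ (f : D → ℕ) (g : A → B → D) xs ys →
  ∑ (cartesianProductWith g xs ys) f ≡ ∑[ x ∈ xs ] ∑[ y ∈ ys ] f (g x y)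
∑-cartesianProductWith f g []       ys = refl
∑-cartesianProductWith f g (x ∷ xs) ys = begin
  ∑ (map (g x) ys ++ cartesianProductWith g xs ys) f
    ≡⟨ ∑-++ f (map (g x) ys) _ ⟩
  ∑ (map (g x) ys) f + ∑ (cartesianProductWith g xs ys) f
    ≡⟨ cong₂ _+_ (∑-map f (g x) ys) (∑-cartesianProductWith f g xs ys) ⟩
  (∑[ y ∈ ys ] f (g x y)) + (∑[ x′ ∈ xs ] ∑[ y ∈ ys ] f (g x′ y)) ∎
  where open ≡-Reasoning

∑-comm : ∀ (f : A → B → ℕ) xs ys → ∑[ x ∈ xs ] ∑[ y ∈ ys ] f x y ≡ ∑[ y ∈ ys ] ∑[ x ∈ xs ] f x y
∑-comm f []       ys = sym (∑-zero (λ _ → refl) ys)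
∑-comm f (x ∷ xs) ys = trans (cong (∑ ys (f x) +_) (∑-comm f xs ys))
                             (sym (∑-+ (f x) (λ y → ∑[ x′ ∈ xs ] f x′ y) ys))

∑-filter : ∀ {P : A → Set} (P? : ∀ x → Dec (P x)) (f : A → ℕ) xs →
  ∑ (filter P? xs) f ≡ ∑[ x ∈ xs ] 𝟙 (does (P? x)) * f x
∑-filter P? f [] = refl
∑-filter P? f (x ∷ xs) with does (P? x)
... | true  = cong₂ _+_ (sym (+-identityʳ (f x))) (∑-filter P? f xs)
... | false = ∑-filter P? f xs

length≡∑1 : ∀ (xs : List A) → length xs ≡ ∑[ _ ∈ xs ] 1
length≡∑1 []       = refl
length≡∑1 (x ∷ xs) = cong suc (length≡∑1 xs)

length-filter : ∀ {P : A → Set} (P? : ∀ x → Dec (P x)) xs → length (filter P? xs) ≡ ∑[ x ∈ xs ] 𝟙 (does (P? x))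
length-filter P? xs = trans (length≡∑1 (filter P? xs))
  (trans (∑-filter P? (λ _ → 1) xs) (∑-cong (λ x → *-identityʳ (𝟙 (does (P? x)))) xs))

T-∧⁻ : ∀ {a b} → T (a ∧ b) → T a × T b
T-∧⁻ = Equivalence.to Bool.T-∧

T-∧⁺ : ∀ {a b} → T a × T b → T (a ∧ b)
T-∧⁺ = Equivalence.from Bool.T-∧

T-∨⁻ : ∀ {a b} → T (a ∨ b) → T a ⊎ T b
T-∨⁻ = Equivalence.to Bool.T-∨

T-∨⁺ : ∀ {a b} → T a ⊎ T b → T (a ∨ b)
T-∨⁺ = Equivalence.from Bool.T-∨

does⁻ : ∀ {P : Set} (P? : Dec P) → T (does P?) → P
does⁻ (yes p) _ = p

does⁺ : ∀ {P : Set} (P? : Dec P) → P → T (does P?)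
does⁺ (yes _) _ = _
does⁺ (no ¬p) p = ¬p p

does-≟true : ∀ b → does (b Bool.≟ true) ≡ b
does-≟true true  = refl
does-≟true false = refl

allB⁺ : ∀ {p : A → Bool} → (∀ x → T (p x)) → ∀ xs → T (allB p xs)
allB⁺ px []       = _
allB⁺ px (x ∷ xs) = T-∧⁺ (px x , allB⁺ px xs)

allB⁻ : ∀ {p : A → Bool} {x xs} → T (allB p xs) → x ∈ xs → T (p x)
allB⁻ all (here refl) = proj₁ (T-∧⁻ all)
allB⁻ all (there x∈)  = allB⁻ (proj₂ (T-∧⁻ all)) x∈

anyB⁺ : ∀ {p : A → Bool} {x xs} → x ∈ xs → T (p x) → T (anyB p xs)
anyB⁺ (here refl) px = T-∨⁺ (inj₁ px)
anyB⁺ (there x∈)  px = T-∨⁺ (inj₂ (anyB⁺ x∈ px))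

anyB⁻ : ∀ {p : A → Bool} xs → T (anyB p xs) → ∃[ x ] T (p x)
anyB⁻ (x ∷ xs) any with T-∨⁻ any
... | inj₁ px   = x , px
... | inj₂ any′ = anyB⁻ xs any′

allB-toList⁺ : ∀ {k} {p : A → Bool} (v : Vec A k) → (∀ i → T (p (lookup v i))) → T (allB p (Vec.toList v))
allB-toList⁺ []      pv = _
allB-toList⁺ (x ∷ v) pv = T-∧⁺ (pv zero , allB-toList⁺ v (pv ∘ suc))

allB-toList⁻ : ∀ {k} {p : A → Bool} (v : Vec A k) → T (allB p (Vec.toList v)) → ∀ i → T (p (lookup v i))
allB-toList⁻ v all i = allB⁻ all (∈-toList⁺ (∈-lookup i v))

anyB-toList⁻ : ∀ {k} {p : A → Bool} (v : Vec A k) → T (anyB p (Vec.toList v)) → ∃[ i ] T (p (lookup v i))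
anyB-toList⁻ (x ∷ v) any with T-∨⁻ any
... | inj₁ px   = zero , px
... | inj₂ any′ = let i , pv = anyB-toList⁻ v any′ in suc i , pv

¬T⇒T-not : ∀ {b} → ¬ T b → T (not b)
¬T⇒T-not {true}  ¬b = ¬b _
¬T⇒T-not {false} _  = _

T-not⇒¬T : ∀ {b} → T (not b) → ¬ T b
T-not⇒¬T {true} ()

if-T : ∀ {b} {x y : A} → T b → (if b then x else y) ≡ x
if-T {b = true} _ = refl

if-¬T : ∀ {b} {x y : A} → ¬ T b → (if b then x else y) ≡ y
if-¬T {b = true}  ¬b = contradiction _ ¬b
if-¬T {b = false} _  = refl

lookup-ext : ∀ {k} {u v : Vec A k} → (∀ i → lookup u i ≡ lookup v i) → u ≡ v
lookup-ext {u = u} {v} u≗v = trans (sym (Vec.tabulate∘lookup u)) (trans (Vec.tabulate-cong u≗v) (Vec.tabulate∘lookup v))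

multiplicity : DecidableEquality A → A → List A → ℕ
multiplicity _≟_ x ys = ∑[ y ∈ ys ] 𝟙 (does (y ≟ x))

∑-select : ∀ (_≟_ : DecidableEquality A) (g : A → ℕ) x ys →
  ∑[ y ∈ ys ] 𝟙 (does (y ≟ x)) * g y ≡ multiplicity _≟_ x ys * g x
∑-select _≟_ g x ys = trans (∑-cong term ys) (∑-*ʳ (g x) (λ y → 𝟙 (does (y ≟ x))) ys)
  where
  term : ∀ y → 𝟙 (does (y ≟ x)) * g y ≡ 𝟙 (does (y ≟ x)) * g x
  term y with y ≟ x
  ... | yes refl = refl
  ... | no  _    = refl

record Enumeration (A : Set) : Set where
  field
    _≟_            : DecidableEquality A
    elements       : List A
    multiplicity≡1 : ∀ x → multiplicity _≟_ x elements ≡ 1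

open Enumeration using (elements; multiplicity≡1)

module _ (EA : Enumeration A) (EB : Enumeration B) {P : A → Bool} {Q : B → Bool}
         (to : ∀ x → T (P x) → B) (from : B → A)
         (from∘to : ∀ x p → from (to x p) ≡ x)
         (to∘from : ∀ y p → T (Q y) → to (from y) p ≡ y)
         (to-Q : ∀ x p → T (Q (to x p)))
         (from-P : ∀ y → T (Q y) → T (P (from y)))
  where

  open Enumeration EA using () renaming (_≟_ to _≟ᴬ_)
  open Enumeration EB using () renaming (_≟_ to _≟ᴮ_)

  private
    fibre : ∀ x → ∑[ y ∈ elements EB ] 𝟙 (does (x ≟ᴬ from y)) * 𝟙 (Q y) ≡ 𝟙 (P x)
    fibre x with T? (P x)
    ... | yes p = trans (∑-cong term (elements EB)) (trans (multiplicity≡1 EB (to x p)) (sym (T⇒𝟙≡1 p)))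
      where
      term : ∀ y → 𝟙 (does (x ≟ᴬ from y)) * 𝟙 (Q y) ≡ 𝟙 (does (y ≟ᴮ to x p))
      term y = trans (sym (𝟙-∧ _ (Q y))) (cong 𝟙 (does-⇔
        (mk⇔ (λ { (refl , q) → sym (to∘from y p q) }) (λ { refl → sym (from∘to x p) , to-Q x p }))
        (x ≟ᴬ from y ×-dec T? (Q y)) (y ≟ᴮ to x p)))
    ... | no ¬p = trans (∑-zero term (elements EB)) (sym (¬T⇒𝟙≡0 ¬p))
      where
      term : ∀ y → 𝟙 (does (x ≟ᴬ from y)) * 𝟙 (Q y) ≡ 0
      term y = trans (sym (𝟙-∧ _ (Q y))) (cong 𝟙 (dec-false (x ≟ᴬ from y ×-dec T? (Q y))
        (λ { (refl , q) → ¬p (from-P y q) })))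

  count-bijection : ∑ (elements EA) (𝟙 ∘ P) ≡ ∑ (elements EB) (𝟙 ∘ Q)
  count-bijection = sym (begin
    ∑[ y ∈ elements EB ] 𝟙 (Q y)
      ≡⟨ ∑-cong (λ y → trans (sym (*-identityˡ (𝟙 (Q y))))
                             (cong (_* 𝟙 (Q y)) (sym (multiplicity≡1 EA (from y))))) (elements EB) ⟩
    ∑[ y ∈ elements EB ] multiplicity _≟ᴬ_ (from y) (elements EA) * 𝟙 (Q y)
      ≡⟨ ∑-cong (λ y → sym (∑-*ʳ (𝟙 (Q y)) _ (elements EA))) (elements EB) ⟩
    ∑[ y ∈ elements EB ] ∑[ x ∈ elements EA ] 𝟙 (does (x ≟ᴬ from y)) * 𝟙 (Q y)
      ≡⟨ ∑-comm _ (elements EB) (elements EA) ⟩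
    ∑[ x ∈ elements EA ] ∑[ y ∈ elements EB ] 𝟙 (does (x ≟ᴬ from y)) * 𝟙 (Q y)
      ≡⟨ ∑-cong fibre (elements EA) ⟩
    ∑[ x ∈ elements EA ] 𝟙 (P x) ∎)
    where open ≡-Reasoning

length≤elements : ∀ (E : Enumeration A) {xs} → (∀ x → multiplicity (Enumeration._≟_ E) x xs ≤ 1) →
  length xs ≤ length (elements E)
length≤elements E {xs} simple = begin
  length xs                                                  ≡⟨ length≡∑1 xs ⟩
  ∑[ y ∈ xs ] 1                                              ≡⟨ ∑-cong (λ y → sym (multiplicity≡1 E y)) xs ⟩
  ∑[ y ∈ xs ] ∑[ x ∈ elements E ] 𝟙 (does (x ≟ y))           ≡⟨ ∑-comm _ xs (elements E) ⟩
  ∑[ x ∈ elements E ] ∑[ y ∈ xs ] 𝟙 (does (x ≟ y))           ≡⟨ ∑-cong (λ x → ∑-cong (𝟙-≟-sym x) xs) (elements E) ⟩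
  ∑[ x ∈ elements E ] multiplicity _≟_ x xs                  ≤⟨ ∑-mono-≤ simple (elements E) ⟩
  ∑[ _ ∈ elements E ] 1                                      ≡⟨ length≡∑1 (elements E) ⟨
  length (elements E)                                        ∎
  where
  open ≤-Reasoning
  open Enumeration E using (_≟_)
  𝟙-≟-sym : ∀ x y → 𝟙 (does (x ≟ y)) ≡ 𝟙 (does (y ≟ x))
  𝟙-≟-sym x y = cong 𝟙 (does-⇔ (mk⇔ sym sym) (x ≟ y) (y ≟ x))

∑-allFin-suc : ∀ {n} (f : Fin (suc n) → ℕ) → ∑ (allFin (suc n)) f ≡ f zero + ∑ (allFin n) (f ∘ suc)
∑-allFin-suc f = cong (λ xs → f zero + sumℕ xs) (trans (List.map-tabulate suc f) (sym (List.map-tabulate id (f ∘ suc))))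

multiplicity-cartesianProductWith :
  ∀ (_≟ᴬ_ : DecidableEquality A) (_≟ᴮ_ : DecidableEquality B) (_≟ᴰ_ : DecidableEquality D)
    (g : A → B → D) → (∀ {x x′ y y′} → g x y ≡ g x′ y′ → x ≡ x′ × y ≡ y′) → ∀ x y xs ys →
  multiplicity _≟ᴰ_ (g x y) (cartesianProductWith g xs ys) ≡ multiplicity _≟ᴬ_ x xs * multiplicity _≟ᴮ_ y ys
multiplicity-cartesianProductWith _≟ᴬ_ _≟ᴮ_ _≟ᴰ_ g g-injective x y xs ys = begin
  multiplicity _≟ᴰ_ (g x y) (cartesianProductWith g xs ys)
    ≡⟨ ∑-cartesianProductWith _ g xs ys ⟩
  ∑[ x′ ∈ xs ] ∑[ y′ ∈ ys ] 𝟙 (does (g x′ y′ ≟ᴰ g x y))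
    ≡⟨ ∑-cong (λ x′ → ∑-cong (term x′) ys) xs ⟩
  ∑[ x′ ∈ xs ] ∑[ y′ ∈ ys ] 𝟙 (does (x′ ≟ᴬ x)) * 𝟙 (does (y′ ≟ᴮ y))
    ≡⟨ ∑-cong (λ x′ → ∑-*ˡ (𝟙 (does (x′ ≟ᴬ x))) _ ys) xs ⟩
  ∑[ x′ ∈ xs ] 𝟙 (does (x′ ≟ᴬ x)) * multiplicity _≟ᴮ_ y ys
    ≡⟨ ∑-*ʳ (multiplicity _≟ᴮ_ y ys) _ xs ⟩
  multiplicity _≟ᴬ_ x xs * multiplicity _≟ᴮ_ y ys ∎
  where
  open ≡-Reasoning
  term : ∀ x′ y′ → 𝟙 (does (g x′ y′ ≟ᴰ g x y)) ≡ 𝟙 (does (x′ ≟ᴬ x)) * 𝟙 (does (y′ ≟ᴮ y))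
  term x′ y′ = trans
    (cong 𝟙 (does-⇔ (mk⇔ g-injective (λ { (refl , refl) → refl })) (g x′ y′ ≟ᴰ g x y) (x′ ≟ᴬ x ×-dec y′ ≟ᴮ y)))
                     (𝟙-∧ (does (x′ ≟ᴬ x)) (does (y′ ≟ᴮ y)))

enumWith : (E : Enumeration A) → ∀ {xs} → xs ≡ elements E → Enumeration A
enumWith E {xs} xs≡ = record E
  { elements       = xs
  ; multiplicity≡1 = λ x → subst (λ ys → multiplicity (Enumeration._≟_ E) x ys ≡ 1) (sym xs≡) (multiplicity≡1 E x) }

enumFin : ∀ n → Enumeration (Fin n)
enumFin n = record { _≟_ = Fin._≟_ ; elements = allFin n ; multiplicity≡1 = once n }
  where
  once : ∀ n (x : Fin n) → multiplicity Fin._≟_ x (allFin n) ≡ 1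
  once (suc n) zero    = trans (∑-allFin-suc {n} (λ y → 𝟙 (does (y Fin.≟ zero))))
                               (cong suc (∑-zero (λ _ → refl) (allFin n)))
  once (suc n) (suc x) = trans (∑-allFin-suc {n} (λ y → 𝟙 (does (y Fin.≟ suc x)))) (once n x)

enumBool : Enumeration Bool
enumBool = record { _≟_ = Bool._≟_ ; elements = true ∷ false ∷ [] ; multiplicity≡1 = λ { true → refl ; false → refl } }

enum× : Enumeration A → Enumeration B → Enumeration (A × B)
enum× EA EB = record
  { _≟_            = _≟×_
  ; elements       = cartesianProduct (elements EA) (elements EB)
  ; multiplicity≡1 = λ (x , y) → trans
      (multiplicity-cartesianProductWith _≟ᴬ_ _≟ᴮ_ _≟×_ _,_ Product.,-injective x y (elements EA) (elements EB))
      (cong₂ _*_ (multiplicity≡1 EA x) (multiplicity≡1 EB y)) }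
  where
  open Enumeration EA using () renaming (_≟_ to _≟ᴬ_)
  open Enumeration EB using () renaming (_≟_ to _≟ᴮ_)
  _≟×_ : DecidableEquality (_ × _)
  _≟×_ = Product.≡-dec _≟ᴬ_ _≟ᴮ_

vecs : List A → ∀ k → List (Vec A k)
vecs xs zero    = [] ∷ []
vecs xs (suc k) = cartesianProductWith _∷_ xs (vecs xs k)

enumVec : Enumeration A → ∀ k → Enumeration (Vec A k)
enumVec E k = record { _≟_ = _≟ᵛ_ ; elements = vecs (elements E) k ; multiplicity≡1 = once k }
  where
  open Enumeration E using (_≟_)
  _≟ᵛ_ : ∀ {k} → DecidableEquality (Vec _ k)
  _≟ᵛ_ = Vec.≡-dec _≟_
  once : ∀ k v → multiplicity _≟ᵛ_ v (vecs (elements E) k) ≡ 1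
  once zero    []      = refl
  once (suc k) (x ∷ v) = trans
    (multiplicity-cartesianProductWith _≟_ _≟ᵛ_ _≟ᵛ_ _∷_ Vec.∷-injective x v (elements E) (vecs (elements E) k))
    (cong₂ _*_ (multiplicity≡1 E x) (once k v))

concatMap-map≡cartesianProductWith : ∀ (g : A → B → D) xs ys →
  concatMap (λ x → map (g x) ys) xs ≡ cartesianProductWith g xs ys
concatMap-map≡cartesianProductWith g []       ys = refl
concatMap-map≡cartesianProductWith g (x ∷ xs) ys = cong (map (g x) ys ++_) (concatMap-map≡cartesianProductWith g xs ys)

allVecs≡vecs : ∀ n k → allVecs n k ≡ vecs (allFin n) k
allVecs≡vecs n zero    = refl
allVecs≡vecs n (suc k) = trans (cong (λ vs → concatMap (λ x → map (x ∷_) vs) (allFin n)) (allVecs≡vecs n k))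
                               (concatMap-map≡cartesianProductWith _∷_ (allFin n) _)

allTuples≡vecs : ∀ n m → allTuples n m ≡ vecs (allVecs n n) m
allTuples≡vecs n zero    = refl
allTuples≡vecs n (suc m) = trans (cong (λ ts → concatMap (λ π → map (π ∷_) ts) (allVecs n n)) (allTuples≡vecs n m))
                                 (concatMap-map≡cartesianProductWith _∷_ (allVecs n n) _)

enumColourings : ∀ χ n → Enumeration (Vec (Fin χ) n)
enumColourings χ n = enumWith (enumVec (enumFin χ) n) (allVecs≡vecs χ n)

enumTuples : ∀ n m → Enumeration (Tuple n m)
enumTuples n m = enumWith (enumVec (enumColourings n n) m) (allTuples≡vecs n m)

enumSubsets : ∀ n → Enumeration (Subset n)
enumSubsets = enumVec enumBool

Commute : ∀ {n} → Map n → Map n → Set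
Commute π σ = ∀ x → app π (app σ x) ≡ app σ (app π x)

CommutingTuple : ∀ {n m} → Tuple n m → Set
CommutingTuple t = (∀ k → Injective _≡_ _≡_ (app (lookup t k))) × (∀ k l → Commute (lookup t k) (lookup t l))

isPermB⇒injective : ∀ {n} (π : Map n) → T (isPermB π) → Injective _≡_ _≡_ (app π)
isPermB⇒injective π perm {x} {y} πx≡πy = toWitness
  (subst (λ b → T (not b ∨ (x == y))) (Equivalence.to Bool.T-≡ (fromWitness πx≡πy))
         (allB⁻ (allB⁻ perm (∈-allFin x)) (∈-allFin y)))

injective⇒isPermB : ∀ {n} (π : Map n) → Injective _≡_ _≡_ (app π) → T (isPermB π)
injective⇒isPermB {n} π π-injective = allB⁺ (λ x → allB⁺ (injective-at x) (allFin n)) (allFin n)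
  where
  injective-at : ∀ x y → T (not (app π x == app π y) ∨ (x == y))
  injective-at x y with app π x Fin.≟ app π y
  ... | yes πx≡πy = fromWitness (π-injective πx≡πy)
  ... | no  _     = _

isComB⇒commutingTuple : ∀ {n m} (t : Tuple n m) → T (isComB t) → CommutingTuple t
isComB⇒commutingTuple t com = injective , commute
  where
  perms : T (allB isPermB (Vec.toList t))
  perms = proj₁ (T-∧⁻ com)
  comms : T (allB (λ π → allB (commB π) (Vec.toList t)) (Vec.toList t))
  comms = proj₂ (T-∧⁻ com)
  injective : ∀ k → Injective _≡_ _≡_ (app (lookup t k))
  injective k = isPermB⇒injective (lookup t k) (allB-toList⁻ t perms k)
  commute : ∀ k l → Commute (lookup t k) (lookup t l)
  commute k l x = toWitness
    (allB⁻ {p = λ x → app (lookup t k) (app (lookup t l) x) == app (lookup t l) (app (lookup t k) x)}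
           (allB-toList⁻ {p = commB (lookup t k)} t (allB-toList⁻ t comms k) l) (∈-allFin x))

commutingTuple⇒isComB : ∀ {n m} (t : Tuple n m) → CommutingTuple t → T (isComB t)
commutingTuple⇒isComB {n} t (injective , commute) = T-∧⁺
  ( allB-toList⁺ t (λ k → injective⇒isPermB (lookup t k) (injective k))
  , allB-toList⁺ t (λ k → allB-toList⁺ t (λ l → allB⁺ (λ x → fromWitness (commute k l x)) (allFin n))))

module _ {e : A → B} (e-injective : Injective _≡_ _≡_ e) {f̂ : A → A} {f : B → B} (f̂~f : e ∘ f̂ ≗ f ∘ e) where

  intertwined-injective : Injective _≡_ _≡_ f → Injective _≡_ _≡_ f̂
  intertwined-injective f-injective {x} {y} f̂x≡f̂y =
    e-injective (f-injective (trans (sym (f̂~f x)) (trans (cong e f̂x≡f̂y) (f̂~f y))))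

  intertwined-commute : ∀ {ĝ : A → A} {g : B → B} → e ∘ ĝ ≗ g ∘ e → f ∘ g ≗ g ∘ f → f̂ ∘ ĝ ≗ ĝ ∘ f̂
  intertwined-commute {ĝ} {g} ĝ~g fg≗gf x = e-injective (begin
    e (f̂ (ĝ x))  ≡⟨ f̂~f (ĝ x) ⟩
    f (e (ĝ x))  ≡⟨ cong f (ĝ~g x) ⟩
    f (g (e x))  ≡⟨ fg≗gf (e x) ⟩
    g (f (e x))  ≡⟨ cong g (f̂~f x) ⟨
    g (e (f̂ x))  ≡⟨ ĝ~g (f̂ x) ⟨
    e (ĝ (f̂ x))  ∎)
    where open ≡-Reasoning

commutingTuple-map : ∀ {n k m} (f : Map n → Map k) (t : Tuple n m) →
  (∀ i → Injective _≡_ _≡_ (app (lookup t i)) → Injective _≡_ _≡_ (app (f (lookup t i)))) →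
  (∀ i j → Commute (lookup t i) (lookup t j) → Commute (f (lookup t i)) (f (lookup t j))) →
  CommutingTuple t → CommutingTuple (Vec.map f t)
commutingTuple-map f t f-injective f-commute (injective , commute) =
  (λ i → subst (λ π → Injective _≡_ _≡_ (app π)) (sym (Vec.lookup-map i f t)) (f-injective i (injective i))) ,
  (λ i j → subst₂ Commute (sym (Vec.lookup-map i f t)) (sym (Vec.lookup-map j f t)) (f-commute i j (commute i j)))

commutingTuple-zipWith : ∀ {k l n m} (f : Map k → Map l → Map n) (t₁ : Tuple k m) (t₂ : Tuple l m) →
  (∀ {π₁ π₂} → Injective _≡_ _≡_ (app π₁) → Injective _≡_ _≡_ (app π₂) → Injective _≡_ _≡_ (app (f π₁ π₂))) →
  (∀ {π₁ π₂ σ₁ σ₂} → Commute π₁ σ₁ → Commute π₂ σ₂ → Commute (f π₁ π₂) (f σ₁ σ₂)) →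
  CommutingTuple t₁ → CommutingTuple t₂ → CommutingTuple (Vec.zipWith f t₁ t₂)
commutingTuple-zipWith f t₁ t₂ f-injective f-commute (injective₁ , commute₁) (injective₂ , commute₂) =
  (λ i → subst (λ π → Injective _≡_ _≡_ (app π)) (sym (Vec.lookup-zipWith f i t₁ t₂))
               (f-injective (injective₁ i) (injective₂ i))) ,
  (λ i j → subst₂ Commute (sym (Vec.lookup-zipWith f i t₁ t₂)) (sym (Vec.lookup-zipWith f j t₁ t₂))
                  (f-commute (commute₁ i j) (commute₂ i j)))

-- Colourings vanishing off a set

SupportedOn : ∀ {n χ} → (Fin n → Bool) → Vec (Fin (suc χ)) n → Set
SupportedOn p c = ∀ x → T (p x) ⊎ lookup c x ≡ zero

supportedOn? : ∀ {n χ} (p : Fin n → Bool) (c : Vec (Fin (suc χ)) n) → Dec (SupportedOn p c)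
supportedOn? p c = Fin.all? λ x → T? (p x) ⊎-dec lookup c x Fin.≟ zero

count-supportedOn : ∀ χ {n} (p : Fin n → Bool) →
  ∑[ c ∈ vecs (allFin (suc χ)) n ] 𝟙 (does (supportedOn? p c)) ≡ suc χ ^ (∑[ x ∈ allFin n ] 𝟙 (p x))
count-supportedOn χ {zero}  p = refl
count-supportedOn χ {suc n} p = begin
  ∑[ c ∈ vecs colours (suc n) ] 𝟙 (does (supportedOn? p c))
    ≡⟨ ∑-cartesianProductWith _ _∷_ colours (vecs colours n) ⟩
  ∑[ a ∈ colours ] ∑[ c ∈ vecs colours n ] 𝟙 (head a ∧ does (supportedOn? (p ∘ suc) c))
    ≡⟨ ∑-cong (λ a → ∑-cong (λ c → 𝟙-∧ (head a) _) (vecs colours n)) colours ⟩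
  ∑[ a ∈ colours ] ∑[ c ∈ vecs colours n ] 𝟙 (head a) * 𝟙 (does (supportedOn? (p ∘ suc) c))
    ≡⟨ ∑-cong (λ a → ∑-*ˡ (𝟙 (head a)) _ (vecs colours n)) colours ⟩
  ∑[ a ∈ colours ] 𝟙 (head a) * (∑[ c ∈ vecs colours n ] 𝟙 (does (supportedOn? (p ∘ suc) c)))
    ≡⟨ ∑-*ʳ _ (𝟙 ∘ head) colours ⟩
  (∑[ a ∈ colours ] 𝟙 (head a)) * (∑[ c ∈ vecs colours n ] 𝟙 (does (supportedOn? (p ∘ suc) c)))
    ≡⟨ cong₂ _*_ (count-head (p zero)) (count-supportedOn χ (p ∘ suc)) ⟩
  suc χ ^ 𝟙 (p zero) * suc χ ^ (∑[ x ∈ allFin n ] 𝟙 (p (suc x)))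
    ≡⟨ ^-distribˡ-+-* (suc χ) (𝟙 (p zero)) _ ⟨
  suc χ ^ (𝟙 (p zero) + (∑[ x ∈ allFin n ] 𝟙 (p (suc x))))
    ≡⟨ cong (suc χ ^_) (∑-allFin-suc (𝟙 ∘ p)) ⟨
  suc χ ^ (∑[ x ∈ allFin (suc n) ] 𝟙 (p x)) ∎
  where
  open ≡-Reasoning
  colours = allFin (suc χ)
  head : Fin (suc χ) → Bool
  head a = p zero ∨ does (a Fin.≟ zero)
  count-head : ∀ b → ∑[ a ∈ colours ] 𝟙 (b ∨ does (a Fin.≟ zero)) ≡ suc χ ^ 𝟙 b
  count-head true  = trans (sym (length≡∑1 colours)) (trans (List.length-tabulate id) (sym (*-identityʳ (suc χ))))
  count-head false = multiplicity≡1 (enumFin (suc χ)) zero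

-- Connected components

least : ∀ {n} (p : Fin n → Bool) x → T (p x) → Σ[ y ∈ Fin n ] T (p y) × (∀ z → T (p z) → toℕ y ≤ toℕ z)
least {suc n} p x px with T? (p zero)
... | yes p0 = zero , p0 , λ _ _ → z≤n
least {suc n} p zero    px | no ¬p0 = ⊥-elim (¬p0 px)
least {suc n} p (suc x) px | no ¬p0 =
  let y , py , y-least = least (p ∘ suc) x px
  in  suc y , py , λ { zero p0 → ⊥-elim (¬p0 p0) ; (suc z) pz → s≤s (y-least z pz) }

module Components {n m} (t : Tuple n m) where

  Adjacent : Fin n → Fin n → Set
  Adjacent x y = T (adjB t x y)

  adjacent⁻ : ∀ {x y} → Adjacent x y → ∃[ k ] (app (lookup t k) x ≡ y ⊎ app (lookup t k) y ≡ x)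
  adjacent⁻ {x} {y} adj =
    let k , e = anyB-toList⁻ t adj
    in  k , Sum.map toWitness toWitness (T-∨⁻ {app (lookup t k) x == y} e)

  adjacent⁺ : ∀ {x y} k → app (lookup t k) x ≡ y ⊎ app (lookup t k) y ≡ x → Adjacent x y
  adjacent⁺ {x} {y} k e = anyB⁺ (∈-toList⁺ (∈-lookup k t))
    (T-∨⁺ {app (lookup t k) x == y} (Sum.map fromWitness fromWitness e))

  adjacent-sym : ∀ {x y} → Adjacent x y → Adjacent y x
  adjacent-sym adj = let k , e = adjacent⁻ adj in adjacent⁺ k (Sum.swap e)

  Path : Fin n → Fin n → Set
  Path = Star Adjacent

  steps : ∀ {x y} → Path x y → ℕ
  steps ε       = 0
  steps (_ ◅ p) = suc (steps p)

  vertices : ∀ {x y} → Path x y → List (Fin n)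
  vertices {x} ε       = x ∷ []
  vertices {x} (_ ◅ p) = x ∷ vertices p

  length-vertices : ∀ {x y} (p : Path x y) → length (vertices p) ≡ suc (steps p)
  length-vertices ε       = refl
  length-vertices (_ ◅ p) = cong suc (length-vertices p)

  walk-refl : ∀ k x → T (walkB t k x x)
  walk-refl zero    x = fromWitness refl
  walk-refl (suc k) x = T-∨⁺ {walkB t k x x} (inj₁ (walk-refl k x))

  walk⇒path : ∀ k {x y} → T (walkB t k x y) → Path x y
  walk⇒path zero    {x} w = subst (Path x) (toWitness w) ε
  walk⇒path (suc k) {x} {y} w with T-∨⁻ {walkB t k x y} w
  ... | inj₁ w′   = walk⇒path k w′
  ... | inj₂ step =
    let z , adj-walk = anyB⁻ {p = λ z → adjB t x z ∧ walkB t k z y} (allFin n) step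
        adj , w′     = T-∧⁻ adj-walk
    in  adj ◅ walk⇒path k w′

  path⇒walk : ∀ {k x y} (p : Path x y) → steps p ≤ k → T (walkB t k x y)
  path⇒walk {k} {x} ε _ = walk-refl k x
  path⇒walk {suc k} {x} {y} (adj ◅ p) (s≤s p≤k) =
    T-∨⁺ {walkB t k x y} (inj₂ (anyB⁺ {p = λ z → adjB t x z ∧ walkB t k z y} (∈-allFin _) (T-∧⁺ (adj , path⇒walk p p≤k))))

  mult : Fin n → List (Fin n) → ℕ
  mult = multiplicity Fin._≟_

  Simple : ∀ {x y} → Path x y → Set
  Simple p = ∀ v → mult v (vertices p) ≤ 1

  suffix : ∀ v {x y} (p : Path x y) → 1 ≤ mult v (vertices p) →
    Σ[ q ∈ Path v y ] (∀ u → mult u (vertices q) ≤ mult u (vertices p))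
  suffix v {x} ε v∈p with x Fin.≟ v
  ... | yes refl = ε , λ _ → ≤-refl
  ... | no  _    = contradiction v∈p λ ()
  suffix v {x} (adj ◅ p) v∈p with x Fin.≟ v
  ... | yes refl = adj ◅ p , λ _ → ≤-refl
  ... | no  _    = let q , q≤p = suffix v p v∈p in q , λ u → ≤-trans (q≤p u) (m≤n+m _ _)

  -- connB only searches walks of at most n steps, so transitivity of Connected needs paths
  -- that visit every vertex at most once.
  shorten : ∀ {x y} → Path x y → Σ[ q ∈ Path x y ] Simple q
  shorten {x} ε = ε , λ v → ≤-trans (≤-reflexive (+-identityʳ _)) (𝟙≤1 (does (x Fin.≟ v)))
  shorten {x} (adj ◅ p) with shorten p
  ... | q , q-simple with mult x (vertices q) in x∉q
  ...   | zero  = adj ◅ q , simple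
    where
    simple : Simple (adj ◅ q)
    simple v with x Fin.≟ v
    ... | yes refl = s≤s (≤-reflexive x∉q)
    ... | no  _    = q-simple v
  ...   | suc _ = let r , r≤q = suffix x q (≤-trans (s≤s z≤n) (≤-reflexive (sym x∉q)))
                  in  r , λ v → ≤-trans (r≤q v) (q-simple v)

  Connected : Fin n → Fin n → Set
  Connected x y = T (connB t x y)

  connected⇒path : ∀ {x y} → Connected x y → Path x y
  connected⇒path = walk⇒path n

  path⇒connected : ∀ {x y} → Path x y → Connected x y
  path⇒connected p = let q , q-simple = shorten p in path⇒walk q (begin
    steps q                    ≤⟨ n≤1+n (steps q) ⟩
    suc (steps q)              ≡⟨ length-vertices q ⟨
    length (vertices q)        ≤⟨ length≤elements (enumFin n) {vertices q} q-simple ⟩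
    length (allFin n)          ≡⟨ List.length-tabulate id ⟩
    n                          ∎)
    where open ≤-Reasoning

  connected-refl : ∀ x → Connected x x
  connected-refl = walk-refl n

  connected-sym : ∀ {x y} → Connected x y → Connected y x
  connected-sym c = path⇒connected (Star.reverse adjacent-sym (connected⇒path c))

  connected-trans : ∀ {x y z} → Connected x y → Connected y z → Connected x z
  connected-trans c d = path⇒connected (connected⇒path c ◅◅ connected⇒path d)

  connected-app : ∀ k x → Connected x (app (lookup t k) x)
  connected-app k x = path⇒connected (adjacent⁺ k (inj₁ refl) ◅ ε)

  representative : Fin n → Fin n
  representative x = proj₁ (least (connB t x) x (connected-refl x))

  connected-representative : ∀ x → Connected x (representative x)
  connected-representative x = proj₁ (proj₂ (least (connB t x) x (connected-refl x)))

  representative-≤ : ∀ {x z} → Connected x z → toℕ (representative x) ≤ toℕ z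
  representative-≤ {x} {z} = proj₂ (proj₂ (least (connB t x) x (connected-refl x))) z

  representative-cong : ∀ {x y} → Connected x y → representative x ≡ representative y
  representative-cong c = Fin.toℕ-injective (≤-antisym
    (representative-≤ (connected-trans c (connected-representative _)))
    (representative-≤ (connected-trans (connected-sym c) (connected-representative _))))

  representative-app : ∀ k x → representative (app (lookup t k) x) ≡ representative x
  representative-app k x = sym (representative-cong (connected-app k x))

  isRepresentative : Fin n → Bool
  isRepresentative x = not (anyB (λ y → (toℕ y <ᵇ toℕ x) ∧ connB t x y) (allFin n))

  ncomp≡∑isRepresentative : ncomp t ≡ ∑[ x ∈ allFin n ] 𝟙 (isRepresentative x)
  ncomp≡∑isRepresentative = trans (length-filter (λ x → isRepresentative x Bool.≟ true) (allFin n))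
    (∑-cong (λ x → cong 𝟙 (does-≟true (isRepresentative x))) (allFin n))

  isRepresentative-representative : ∀ x → T (isRepresentative (representative x))
  isRepresentative-representative x = ¬T⇒T-not λ smaller →
    let y , y<r∧c = anyB⁻ {p = λ y → (toℕ y <ᵇ toℕ (representative x)) ∧ connB t (representative x) y} (allFin n) smaller
        y<r , c   = T-∧⁻ y<r∧c
    in  <⇒≱ (<ᵇ⇒< _ _ y<r) (representative-≤ (connected-trans (connected-representative x) c))

  representative-isRepresentative : ∀ {x} → T (isRepresentative x) → representative x ≡ x
  representative-isRepresentative {x} rep = Fin.toℕ-injective (≤-antisym (representative-≤ (connected-refl x))
    (≮⇒≥ λ r<x → T-not⇒¬T rep (anyB⁺ (∈-allFin (representative x)) (T-∧⁺ (<⇒<ᵇ r<x , connected-representative x)))))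

  Invariant : ∀ {χ} → Vec (Fin χ) n → Set
  Invariant c = ∀ k x → lookup c (app (lookup t k) x) ≡ lookup c x

  invariant? : ∀ {χ} (c : Vec (Fin χ) n) → Dec (Invariant c)
  invariant? c = Fin.all? λ k → Fin.all? λ x → lookup c (app (lookup t k) x) Fin.≟ lookup c x

  invariant-path : ∀ {χ} (c : Vec (Fin χ) n) → Invariant c → ∀ {x y} → Path x y → lookup c x ≡ lookup c y
  invariant-path c inv ε = refl
  invariant-path c inv (adj ◅ p) with adjacent⁻ adj
  ... | k , inj₁ πx≡y = trans (trans (sym (inv k _)) (cong (lookup c) πx≡y)) (invariant-path c inv p)
  ... | k , inj₂ πy≡x = trans (trans (cong (lookup c) (sym πy≡x)) (inv k _)) (invariant-path c inv p)

  invariant-representative : ∀ {χ} (c : Vec (Fin χ) n) → Invariant c → ∀ x → lookup c (representative x) ≡ lookup c x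
  invariant-representative c inv x = sym (invariant-path c inv (connected⇒path (connected-representative x)))

  onRepresentatives : ∀ {χ} → Vec (Fin (suc χ)) n → Vec (Fin (suc χ)) n
  onRepresentatives c = Vec.tabulate λ x → if isRepresentative x then lookup c x else zero

  spread : ∀ {χ} → Vec (Fin χ) n → Vec (Fin χ) n
  spread c = Vec.tabulate (lookup c ∘ representative)

  spread-invariant : ∀ {χ} (c : Vec (Fin χ) n) → Invariant (spread c)
  spread-invariant c k x = trans (Vec.lookup∘tabulate (lookup c ∘ representative) _)
    (trans (cong (lookup c) (representative-app k x)) (sym (Vec.lookup∘tabulate (lookup c ∘ representative) x)))

  onRepresentatives-supported : ∀ {χ} (c : Vec (Fin (suc χ)) n) → SupportedOn isRepresentative (onRepresentatives c)
  onRepresentatives-supported c x with T? (isRepresentative x)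
  ... | yes rep = inj₁ rep
  ... | no ¬rep = inj₂ (trans (Vec.lookup∘tabulate _ x) (if-¬T ¬rep))

  spread∘onRepresentatives : ∀ {χ} (c : Vec (Fin (suc χ)) n) → Invariant c → spread (onRepresentatives c) ≡ c
  spread∘onRepresentatives c inv = lookup-ext λ x → begin
    lookup (spread (onRepresentatives c)) x
      ≡⟨ Vec.lookup∘tabulate _ x ⟩
    lookup (onRepresentatives c) (representative x)
      ≡⟨ Vec.lookup∘tabulate _ (representative x) ⟩
    (if isRepresentative (representative x) then lookup c (representative x) else zero)
      ≡⟨ if-T (isRepresentative-representative x) ⟩
    lookup c (representative x)
      ≡⟨ invariant-representative c inv x ⟩
    lookup c x ∎
    where open ≡-Reasoning

  onRepresentatives∘spread : ∀ {χ} (c : Vec (Fin (suc χ)) n) → SupportedOn isRepresentative c →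
    onRepresentatives (spread c) ≡ c
  onRepresentatives∘spread c supported = lookup-ext λ x → trans (Vec.lookup∘tabulate _ x) (at x)
    where
    at : ∀ x → (if isRepresentative x then lookup (spread c) x else zero) ≡ lookup c x
    at x with T? (isRepresentative x) | supported x
    ... | yes rep | _        = trans (if-T rep) (trans (Vec.lookup∘tabulate _ x)
                                                      (cong (lookup c) (representative-isRepresentative rep)))
    ... | no ¬rep | inj₁ rep = contradiction rep ¬rep
    ... | no ¬rep | inj₂ c≡0 = trans (if-¬T ¬rep) (sym c≡0)

  count-invariant : ∀ χ → ∑[ c ∈ allVecs (suc χ) n ] 𝟙 (does (invariant? c)) ≡
                          ∑[ c ∈ allVecs (suc χ) n ] 𝟙 (does (supportedOn? isRepresentative c))
  count-invariant χ = count-bijection (enumColourings (suc χ) n) (enumColourings (suc χ) n)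
    (λ c _ → onRepresentatives c) spread
    (λ c inv → spread∘onRepresentatives c (does⁻ (invariant? c) inv))
    (λ c _ supported → onRepresentatives∘spread c (does⁻ (supportedOn? isRepresentative c) supported))
    (λ c _ → does⁺ (supportedOn? isRepresentative (onRepresentatives c)) (onRepresentatives-supported c))
    (λ c _ → does⁺ (invariant? (spread c)) (spread-invariant c))

invariant-count : ∀ χ {n m} (t : Tuple n m) → χ ^ ncomp t ≡ ∑[ c ∈ allVecs χ n ] 𝟙 (does (Components.invariant? t c))
invariant-count zero {zero} t = cong (_+ 0) (sym (T⇒𝟙≡1 (does⁺ (invariant? []) λ _ ())))
  where open Components t
invariant-count zero {suc n} t =
  cong (0 ^_) (trans ncomp≡∑isRepresentative (trans (∑-allFin-suc (𝟙 ∘ isRepresentative))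
    (cong (_+ (∑[ x ∈ allFin n ] 𝟙 (isRepresentative (suc x)))) (T⇒𝟙≡1 zero-isRepresentative))))
  where
  open Components t
  zero-isRepresentative : T (isRepresentative zero)
  zero-isRepresentative = subst (T ∘ isRepresentative)
    (Fin.toℕ-injective (n≤0⇒n≡0 (representative-≤ (connected-refl zero)))) (isRepresentative-representative zero)
invariant-count (suc χ) {n} t = begin
  suc χ ^ ncomp t
    ≡⟨ cong (suc χ ^_) ncomp≡∑isRepresentative ⟩
  suc χ ^ (∑[ x ∈ allFin n ] 𝟙 (isRepresentative x))
    ≡⟨ count-supportedOn χ isRepresentative ⟨
  ∑[ c ∈ vecs (allFin (suc χ)) n ] 𝟙 (does (supportedOn? isRepresentative c))
    ≡⟨ cong (λ cs → ∑[ c ∈ cs ] 𝟙 (does (supportedOn? isRepresentative c))) (allVecs≡vecs (suc χ) n) ⟨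
  ∑[ c ∈ allVecs (suc χ) n ] 𝟙 (does (supportedOn? isRepresentative c))
    ≡⟨ count-invariant χ ⟨
  ∑[ c ∈ allVecs (suc χ) n ] 𝟙 (does (invariant? c)) ∎
  where
  open ≡-Reasoning
  open Components t

-- Splitting along a subset

side : ∀ {k l} → Fin k ⊎ Fin l → Bool
side = Sum.[ (λ _ → inside) , (λ _ → outside) ]

split : ∀ {n} (S : Subset n) → Fin n → Fin ∣ S ∣ ⊎ Fin ∣ ∁ S ∣
split (inside  ∷ S) zero    = inj₁ zero
split (inside  ∷ S) (suc x) = Sum.map₁ suc (split S x)
split (outside ∷ S) zero    = inj₂ zero
split (outside ∷ S) (suc x) = Sum.map₂ suc (split S x)

join : ∀ {n} (S : Subset n) → Fin ∣ S ∣ ⊎ Fin ∣ ∁ S ∣ → Fin n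
join (inside  ∷ S) (inj₁ zero)    = zero
join (inside  ∷ S) (inj₁ (suc a)) = suc (join S (inj₁ a))
join (inside  ∷ S) (inj₂ b)       = suc (join S (inj₂ b))
join (outside ∷ S) (inj₁ a)       = suc (join S (inj₁ a))
join (outside ∷ S) (inj₂ zero)    = zero
join (outside ∷ S) (inj₂ (suc b)) = suc (join S (inj₂ b))

join-split : ∀ {n} (S : Subset n) x → join S (split S x) ≡ x
join-split (inside  ∷ S) zero    = refl
join-split (outside ∷ S) zero    = refl
join-split (inside  ∷ S) (suc x) with split S x | join-split S x
... | inj₁ a | eq = cong suc eq
... | inj₂ b | eq = cong suc eq
join-split (outside ∷ S) (suc x) with split S x | join-split S x
... | inj₁ a | eq = cong suc eq
... | inj₂ b | eq = cong suc eq

split-join : ∀ {n} (S : Subset n) u → split S (join S u) ≡ u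
split-join (inside  ∷ S) (inj₁ zero)    = refl
split-join (inside  ∷ S) (inj₁ (suc a)) = cong (Sum.map₁ suc) (split-join S (inj₁ a))
split-join (inside  ∷ S) (inj₂ b)       = cong (Sum.map₁ suc) (split-join S (inj₂ b))
split-join (outside ∷ S) (inj₁ a)       = cong (Sum.map₂ suc) (split-join S (inj₁ a))
split-join (outside ∷ S) (inj₂ zero)    = refl
split-join (outside ∷ S) (inj₂ (suc b)) = cong (Sum.map₂ suc) (split-join S (inj₂ b))

lookup-join : ∀ {n} (S : Subset n) u → lookup S (join S u) ≡ side u
lookup-join (inside  ∷ S) (inj₁ zero)    = refl
lookup-join (inside  ∷ S) (inj₁ (suc a)) = lookup-join S (inj₁ a)
lookup-join (inside  ∷ S) (inj₂ b)       = lookup-join S (inj₂ b)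
lookup-join (outside ∷ S) (inj₁ a)       = lookup-join S (inj₁ a)
lookup-join (outside ∷ S) (inj₂ zero)    = refl
lookup-join (outside ∷ S) (inj₂ (suc b)) = lookup-join S (inj₂ b)

lookup≡side-split : ∀ {n} (S : Subset n) x → lookup S x ≡ side (split S x)
lookup≡side-split S x = trans (cong (lookup S) (sym (join-split S x))) (lookup-join S (split S x))

split-injective : ∀ {n} (S : Subset n) → Injective _≡_ _≡_ (split S)
split-injective S {x} {y} eq = trans (sym (join-split S x)) (trans (cong (join S) eq) (join-split S y))

join-injective : ∀ {n} (S : Subset n) → Injective _≡_ _≡_ (join S)
join-injective S {u} {v} eq = trans (sym (split-join S u)) (trans (cong (split S) eq) (split-join S v))

module Restriction {n} (S : Subset n) where

  Preserves : Map n → Set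
  Preserves π = ∀ x → lookup S (app π x) ≡ lookup S x

  -- The defaults a and b in the two restrictions are never used when π preserves S.
  restrict₁ : Map n → Map ∣ S ∣
  restrict₁ π = Vec.tabulate λ a → Sum.[ id , (λ _ → a) ] (split S (app π (join S (inj₁ a))))

  restrict₂ : Map n → Map ∣ ∁ S ∣
  restrict₂ π = Vec.tabulate λ b → Sum.[ (λ _ → b) , id ] (split S (app π (join S (inj₂ b))))

  glue : Map ∣ S ∣ → Map ∣ ∁ S ∣ → Map n
  glue π₁ π₂ = Vec.tabulate λ x → join S (Sum.map (app π₁) (app π₂) (split S x))

  restrict₁-intertwines : ∀ {π} → Preserves π → join S ∘ inj₁ ∘ app (restrict₁ π) ≗ app π ∘ join S ∘ inj₁
  restrict₁-intertwines {π} preserves a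
    rewrite Vec.lookup∘tabulate (λ a → Sum.[ id , (λ _ → a) ] (split S (app π (join S (inj₁ a))))) a =
    trans (cong (join S) (on-inside (split S y) (trans (sym (lookup≡side-split S y))
                                                      (trans (preserves _) (lookup-join S (inj₁ a))))))
          (join-split S y)
    where
    y = app π (join S (inj₁ a))
    on-inside : ∀ u → side u ≡ inside → inj₁ (Sum.[ id , (λ _ → a) ] u) ≡ u
    on-inside (inj₁ _) _ = refl

  restrict₂-intertwines : ∀ {π} → Preserves π → join S ∘ inj₂ ∘ app (restrict₂ π) ≗ app π ∘ join S ∘ inj₂
  restrict₂-intertwines {π} preserves b
    rewrite Vec.lookup∘tabulate (λ b → Sum.[ (λ _ → b) , id ] (split S (app π (join S (inj₂ b))))) b =
    trans (cong (join S) (on-outside (split S y) (trans (sym (lookup≡side-split S y))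
                                                        (trans (preserves _) (lookup-join S (inj₂ b))))))
          (join-split S y)
    where
    y = app π (join S (inj₂ b))
    on-outside : ∀ u → side u ≡ outside → inj₂ (Sum.[ (λ _ → b) , id ] u) ≡ u
    on-outside (inj₂ _) _ = refl

  glue-intertwines : ∀ π₁ π₂ → split S ∘ app (glue π₁ π₂) ≗ Sum.map (app π₁) (app π₂) ∘ split S
  glue-intertwines π₁ π₂ x =
    trans (cong (split S) (Vec.lookup∘tabulate _ x)) (split-join S (Sum.map (app π₁) (app π₂) (split S x)))

  join-inj₁-injective : Injective _≡_ _≡_ (join S ∘ inj₁)
  join-inj₁-injective = Sum.inj₁-injective ∘ join-injective S

  join-inj₂-injective : Injective _≡_ _≡_ (join S ∘ inj₂)
  join-inj₂-injective = Sum.inj₂-injective ∘ join-injective S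

  restrict₁-injective : ∀ {π} → Preserves π → Injective _≡_ _≡_ (app π) → Injective _≡_ _≡_ (app (restrict₁ π))
  restrict₁-injective {π} preserves =
    intertwined-injective join-inj₁-injective {f = app π} (restrict₁-intertwines {π} preserves)

  restrict₂-injective : ∀ {π} → Preserves π → Injective _≡_ _≡_ (app π) → Injective _≡_ _≡_ (app (restrict₂ π))
  restrict₂-injective {π} preserves =
    intertwined-injective join-inj₂-injective {f = app π} (restrict₂-intertwines {π} preserves)

  restrict₁-commute : ∀ {π σ} → Preserves π → Preserves σ → Commute π σ → Commute (restrict₁ π) (restrict₁ σ)
  restrict₁-commute {π} {σ} pπ pσ =
    intertwined-commute join-inj₁-injective {f = app π} (restrict₁-intertwines {π} pπ)
                                            {g = app σ} (restrict₁-intertwines {σ} pσ)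

  restrict₂-commute : ∀ {π σ} → Preserves π → Preserves σ → Commute π σ → Commute (restrict₂ π) (restrict₂ σ)
  restrict₂-commute {π} {σ} pπ pσ =
    intertwined-commute join-inj₂-injective {f = app π} (restrict₂-intertwines {π} pπ)
                                            {g = app σ} (restrict₂-intertwines {σ} pσ)

  glue-injective : ∀ {π₁ π₂} → Injective _≡_ _≡_ (app π₁) → Injective _≡_ _≡_ (app π₂) →
                   Injective _≡_ _≡_ (app (glue π₁ π₂))
  glue-injective {π₁} {π₂} inj₁π inj₂π = intertwined-injective (split-injective S) (glue-intertwines π₁ π₂) map-injective
    where
    map-injective : Injective _≡_ _≡_ (Sum.map (app π₁) (app π₂))
    map-injective {inj₁ _} {inj₁ _} eq = cong inj₁ (inj₁π (Sum.inj₁-injective eq))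
    map-injective {inj₂ _} {inj₂ _} eq = cong inj₂ (inj₂π (Sum.inj₂-injective eq))

  glue-commute : ∀ {π₁ π₂ σ₁ σ₂} → Commute π₁ σ₁ → Commute π₂ σ₂ → Commute (glue π₁ π₂) (glue σ₁ σ₂)
  glue-commute {π₁} {π₂} {σ₁} {σ₂} c₁ c₂ =
    intertwined-commute (split-injective S) {f = Sum.map (app π₁) (app π₂)} (glue-intertwines π₁ π₂)
                        {g = Sum.map (app σ₁) (app σ₂)} (glue-intertwines σ₁ σ₂) map-commute
    where
    map-commute : Sum.map (app π₁) (app π₂) ∘ Sum.map (app σ₁) (app σ₂) ≗
                  Sum.map (app σ₁) (app σ₂) ∘ Sum.map (app π₁) (app π₂)
    map-commute (inj₁ a) = cong inj₁ (c₁ a)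
    map-commute (inj₂ b) = cong inj₂ (c₂ b)

  restrict₁-glue : ∀ π₁ π₂ → restrict₁ (glue π₁ π₂) ≡ π₁
  restrict₁-glue π₁ π₂ = lookup-ext λ a → trans (Vec.lookup∘tabulate _ a)
    (cong Sum.[ id , (λ _ → a) ] (trans (glue-intertwines π₁ π₂ (join S (inj₁ a)))
                                        (cong (Sum.map (app π₁) (app π₂)) (split-join S (inj₁ a)))))

  restrict₂-glue : ∀ π₁ π₂ → restrict₂ (glue π₁ π₂) ≡ π₂
  restrict₂-glue π₁ π₂ = lookup-ext λ b → trans (Vec.lookup∘tabulate _ b)
    (cong Sum.[ (λ _ → b) , id ] (trans (glue-intertwines π₁ π₂ (join S (inj₂ b)))
                                        (cong (Sum.map (app π₁) (app π₂)) (split-join S (inj₂ b)))))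

  glue-restrict : ∀ {π} → Preserves π → glue (restrict₁ π) (restrict₂ π) ≡ π
  glue-restrict {π} preserves = lookup-ext λ x → trans (Vec.lookup∘tabulate _ x)
    (trans (on (split S x)) (cong (app π) (join-split S x)))
    where
    on : ∀ u → join S (Sum.map (app (restrict₁ π)) (app (restrict₂ π)) u) ≡ app π (join S u)
    on (inj₁ a) = restrict₁-intertwines {π} preserves a
    on (inj₂ b) = restrict₂-intertwines {π} preserves b

  map-restrict₁-glue : ∀ {m} (t₁ : Tuple (∣ S ∣) m) (t₂ : Tuple (∣ ∁ S ∣) m) →
                       Vec.map restrict₁ (Vec.zipWith glue t₁ t₂) ≡ t₁
  map-restrict₁-glue t₁ t₂ = lookup-ext λ k → trans (Vec.lookup-map k restrict₁ (Vec.zipWith glue t₁ t₂))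
    (trans (cong restrict₁ (Vec.lookup-zipWith glue k t₁ t₂)) (restrict₁-glue (lookup t₁ k) (lookup t₂ k)))

  map-restrict₂-glue : ∀ {m} (t₁ : Tuple (∣ S ∣) m) (t₂ : Tuple (∣ ∁ S ∣) m) →
                       Vec.map restrict₂ (Vec.zipWith glue t₁ t₂) ≡ t₂
  map-restrict₂-glue t₁ t₂ = lookup-ext λ k → trans (Vec.lookup-map k restrict₂ (Vec.zipWith glue t₁ t₂))
    (trans (cong restrict₂ (Vec.lookup-zipWith glue k t₁ t₂)) (restrict₂-glue (lookup t₁ k) (lookup t₂ k)))

  glue-map-restrict : ∀ {m} (t : Tuple n m) → (∀ k → Preserves (lookup t k)) →
    Vec.zipWith glue (Vec.map restrict₁ t) (Vec.map restrict₂ t) ≡ t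
  glue-map-restrict t preserves = lookup-ext λ k → begin
    lookup (Vec.zipWith glue (Vec.map restrict₁ t) (Vec.map restrict₂ t)) k
      ≡⟨ Vec.lookup-zipWith glue k (Vec.map restrict₁ t) (Vec.map restrict₂ t) ⟩
    glue (lookup (Vec.map restrict₁ t) k) (lookup (Vec.map restrict₂ t) k)
      ≡⟨ cong₂ glue (Vec.lookup-map k restrict₁ t) (Vec.lookup-map k restrict₂ t) ⟩
    glue (restrict₁ (lookup t k)) (restrict₂ (lookup t k))
      ≡⟨ glue-restrict (preserves k) ⟩
    lookup t k ∎
    where open ≡-Reasoning

zeroSet : ∀ {n χ} → Vec (Fin (suc χ)) n → Subset n
zeroSet c = Vec.map (_== zero) c

_≟ˢ_ : ∀ {n} → DecidableEquality (Subset n)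
_≟ˢ_ = Vec.≡-dec Bool._≟_

module Decomposition (m χ : ℕ) {n} (S : Subset n) where

  open Restriction S
  open Components using (Invariant; invariant?)

  valid : Tuple n m × Vec (Fin (suc χ)) n → Bool
  valid (t , c) = does (S ≟ˢ zeroSet c) ∧ (isComB t ∧ does (invariant? t c))

  valid′ : (Tuple (∣ S ∣) m × Tuple (∣ ∁ S ∣) m) × Vec (Fin χ) (∣ ∁ S ∣) → Bool
  valid′ ((t₁ , t₂) , c′) = isComB t₁ ∧ (isComB t₂ ∧ does (invariant? t₂ c′))

  valid⁻ : ∀ {t c} → T (valid (t , c)) → zeroSet c ≡ S × CommutingTuple t × Invariant t c
  valid⁻ {t} {c} v =
    let zs , rest = T-∧⁻ v
        com , inv = T-∧⁻ {isComB t} rest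
    in  sym (does⁻ (S ≟ˢ zeroSet c) zs) , isComB⇒commutingTuple t com , does⁻ (invariant? t c) inv

  valid⁺ : ∀ {t c} → zeroSet c ≡ S → CommutingTuple t → Invariant t c → T (valid (t , c))
  valid⁺ {t} {c} zs com inv =
    T-∧⁺ (does⁺ (S ≟ˢ zeroSet c) (sym zs) , T-∧⁺ (commutingTuple⇒isComB t com , does⁺ (invariant? t c) inv))

  valid′⁻ : ∀ {t₁ t₂ c′} → T (valid′ ((t₁ , t₂) , c′)) → CommutingTuple t₁ × CommutingTuple t₂ × Invariant t₂ c′
  valid′⁻ {t₁} {t₂} {c′} v =
    let com₁ , rest = T-∧⁻ v
        com₂ , inv  = T-∧⁻ {isComB t₂} rest
    in  isComB⇒commutingTuple t₁ com₁ , isComB⇒commutingTuple t₂ com₂ , does⁻ (invariant? t₂ c′) inv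

  valid′⁺ : ∀ {t₁ t₂ c′} → CommutingTuple t₁ → CommutingTuple t₂ → Invariant t₂ c′ → T (valid′ ((t₁ , t₂) , c′))
  valid′⁺ {t₁} {t₂} {c′} com₁ com₂ inv =
    T-∧⁺ (commutingTuple⇒isComB t₁ com₁ , T-∧⁺ (commutingTuple⇒isComB t₂ com₂ , does⁺ (invariant? t₂ c′) inv))

  module _ {c : Vec (Fin (suc χ)) n} (zs : zeroSet c ≡ S) where

    isZero≡lookup : ∀ x → (lookup c x == zero) ≡ lookup S x
    isZero≡lookup x = trans (sym (Vec.lookup-map x (_== zero) c)) (cong (λ v → lookup v x) zs)

    invariant⇒preserves : ∀ (t : Tuple n m) → Invariant t c → ∀ k → Preserves (lookup t k)
    invariant⇒preserves t inv k x = trans (sym (isZero≡lookup _)) (trans (cong (_== zero) (inv k x)) (isZero≡lookup x))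

    nonzero-outside : ∀ b → zero ≢ lookup c (join S (inj₂ b))
    nonzero-outside b 0≡c = subst T (trans (isZero≡lookup _) (lookup-join S (inj₂ b))) (fromWitness (sym 0≡c))

    -- punchOut {i = zero} is the predecessor of a nonzero colour.
    restricted : Fin ∣ ∁ S ∣ → Fin χ
    restricted b = punchOut (nonzero-outside b)

    restrictColouring : Vec (Fin χ) ∣ ∁ S ∣
    restrictColouring = Vec.tabulate restricted

    restrictColouring-invariant : ∀ {t : Tuple n m} → Invariant t c → Invariant (Vec.map restrict₂ t) restrictColouring
    restrictColouring-invariant {t} inv k b rewrite Vec.lookup-map k restrict₂ t =
      trans (Vec.lookup∘tabulate restricted _) (trans (Fin.punchOut-cong zero (begin
        lookup c (join S (inj₂ (app (restrict₂ π) b)))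
          ≡⟨ cong (lookup c) (restrict₂-intertwines {π} (invariant⇒preserves t inv k) b) ⟩
        lookup c (app π (join S (inj₂ b)))
          ≡⟨ inv k _ ⟩
        lookup c (join S (inj₂ b)) ∎)) (sym (Vec.lookup∘tabulate restricted b)))
      where
      open ≡-Reasoning
      π = lookup t k

  colourOf : Vec (Fin χ) ∣ ∁ S ∣ → Fin ∣ S ∣ ⊎ Fin ∣ ∁ S ∣ → Fin (suc χ)
  colourOf c′ = Sum.[ (λ _ → zero) , (λ b → suc (lookup c′ b)) ]

  extendColouring : Vec (Fin χ) ∣ ∁ S ∣ → Vec (Fin (suc χ)) n
  extendColouring c′ = Vec.tabulate (colourOf c′ ∘ split S)

  extend∘restrictColouring : ∀ {c} (zs : zeroSet c ≡ S) → extendColouring (restrictColouring zs) ≡ c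
  extend∘restrictColouring {c} zs = lookup-ext λ x →
    trans (Vec.lookup∘tabulate (colourOf c′ ∘ split S) x) (trans (on (split S x)) (cong (lookup c) (join-split S x)))
    where
    c′ = restrictColouring zs
    on : ∀ u → colourOf c′ u ≡ lookup c (join S u)
    on (inj₁ a) = sym (toWitness (subst T (sym (trans (isZero≡lookup zs _) (lookup-join S (inj₁ a)))) _))
    on (inj₂ b) = trans (cong suc (Vec.lookup∘tabulate (restricted zs) b)) (Fin.punchIn-punchOut (nonzero-outside zs b))

  zeroSet-extendColouring : ∀ c′ → zeroSet (extendColouring c′) ≡ S
  zeroSet-extendColouring c′ = lookup-ext λ x →
    trans (Vec.lookup-map x (_== zero) (extendColouring c′))
          (trans (cong (_== zero) (Vec.lookup∘tabulate (colourOf c′ ∘ split S) x))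
                 (trans (on (split S x)) (sym (lookup≡side-split S x))))
    where
    on : ∀ u → (colourOf c′ u == zero) ≡ side u
    on (inj₁ _) = refl
    on (inj₂ _) = refl

  restrict∘extendColouring : ∀ c′ (zs : zeroSet (extendColouring c′) ≡ S) → restrictColouring zs ≡ c′
  restrict∘extendColouring c′ zs = lookup-ext λ b → trans (Vec.lookup∘tabulate (restricted zs) b)
    (Fin.punchOut-cong zero {i≢k = λ ()}
      (trans (Vec.lookup∘tabulate (colourOf c′ ∘ split S) (join S (inj₂ b))) (cong (colourOf c′) (split-join S (inj₂ b)))))

  extendColouring-invariant : ∀ {t₁ : Tuple (∣ S ∣) m} {t₂ : Tuple (∣ ∁ S ∣) m} {c′} →
    Invariant t₂ c′ → Invariant (Vec.zipWith glue t₁ t₂) (extendColouring c′)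
  extendColouring-invariant {t₁} {t₂} {c′} inv k x rewrite Vec.lookup-zipWith glue k t₁ t₂ =
    trans (Vec.lookup∘tabulate (colourOf c′ ∘ split S) _)
          (trans (cong (colourOf c′) (glue-intertwines π₁ π₂ x))
                 (trans (on (split S x)) (sym (Vec.lookup∘tabulate (colourOf c′ ∘ split S) x))))
    where
    π₁ = lookup t₁ k
    π₂ = lookup t₂ k
    on : ∀ u → colourOf c′ (Sum.map (app π₁) (app π₂) u) ≡ colourOf c′ u
    on (inj₁ _) = refl
    on (inj₂ b) = cong suc (inv k b)

  decompose : ∀ x → T (valid x) → (Tuple (∣ S ∣) m × Tuple (∣ ∁ S ∣) m) × Vec (Fin χ) (∣ ∁ S ∣)
  decompose (t , c) v = (Vec.map restrict₁ t , Vec.map restrict₂ t) , restrictColouring (proj₁ (valid⁻ {t} {c} v))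

  assemble : (Tuple (∣ S ∣) m × Tuple (∣ ∁ S ∣) m) × Vec (Fin χ) (∣ ∁ S ∣) → Tuple n m × Vec (Fin (suc χ)) n
  assemble ((t₁ , t₂) , c′) = Vec.zipWith glue t₁ t₂ , extendColouring c′

  assemble∘decompose : ∀ x v → assemble (decompose x v) ≡ x
  assemble∘decompose (t , c) v with valid⁻ {t} {c} v
  ... | zs , _ , inv = cong₂ _,_ (glue-map-restrict t (invariant⇒preserves zs t inv)) (extend∘restrictColouring zs)

  decompose∘assemble : ∀ y v → T (valid′ y) → decompose (assemble y) v ≡ y
  decompose∘assemble ((t₁ , t₂) , c′) v _ =
    cong₂ _,_ (cong₂ _,_ (map-restrict₁-glue t₁ t₂) (map-restrict₂-glue t₁ t₂))
              (restrict∘extendColouring c′ (proj₁ (valid⁻ {Vec.zipWith glue t₁ t₂} {extendColouring c′} v)))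

  decompose-valid : ∀ x v → T (valid′ (decompose x v))
  decompose-valid (t , c) v with valid⁻ {t} {c} v
  ... | zs , com , inv = valid′⁺ {Vec.map restrict₁ t} {Vec.map restrict₂ t} {restrictColouring zs}
    (commutingTuple-map restrict₁ t (λ k → restrict₁-injective {lookup t k} (preserves k))
      (λ k l → restrict₁-commute {lookup t k} {lookup t l} (preserves k) (preserves l)) com)
    (commutingTuple-map restrict₂ t (λ k → restrict₂-injective {lookup t k} (preserves k))
      (λ k l → restrict₂-commute {lookup t k} {lookup t l} (preserves k) (preserves l)) com)
    (restrictColouring-invariant zs {t} inv)
    where
    preserves = invariant⇒preserves zs t inv

  assemble-valid : ∀ y → T (valid′ y) → T (valid (assemble y))
  assemble-valid ((t₁ , t₂) , c′) v′ with valid′⁻ {t₁} {t₂} {c′} v′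
  ... | com₁ , com₂ , inv = valid⁺ {Vec.zipWith glue t₁ t₂} (zeroSet-extendColouring c′)
    (commutingTuple-zipWith glue t₁ t₂ (λ {π₁} {π₂} → glue-injective {π₁} {π₂})
                                       (λ {π₁} {π₂} {σ₁} {σ₂} → glue-commute {π₁} {π₂} {σ₁} {σ₂}) com₁ com₂)
    (extendColouring-invariant {t₁} {t₂} {c′} inv)

  count-decomposition :
    ∑ (elements (enum× (enumTuples n m) (enumColourings (suc χ) n))) (𝟙 ∘ valid) ≡
    ∑ (elements (enum× (enum× (enumTuples (∣ S ∣) m) (enumTuples (∣ ∁ S ∣) m)) (enumColourings χ (∣ ∁ S ∣)))) (𝟙 ∘ valid′)
  count-decomposition = count-bijection (enum× (enumTuples n m) (enumColourings (suc χ) n))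
    (enum× (enum× (enumTuples (∣ S ∣) m) (enumTuples (∣ ∁ S ∣) m)) (enumColourings χ (∣ ∁ S ∣))) decompose assemble
    assemble∘decompose decompose∘assemble decompose-valid assemble-valid

multiplicity-upTo : ∀ j n → multiplicity ℕ._≟_ j (upTo n) ≡ 𝟙 (does (j <? n))
multiplicity-upTo j zero    = refl
multiplicity-upTo j (suc n) = begin
  multiplicity ℕ._≟_ j (upTo (suc n))                  ≡⟨ cong (multiplicity ℕ._≟_ j) (List.upTo-∷ʳ n) ⟨
  multiplicity ℕ._≟_ j (upTo n ++ n ∷ [])              ≡⟨ ∑-++ (λ k → 𝟙 (does (k ℕ.≟ j))) (upTo n) (n ∷ []) ⟩
  multiplicity ℕ._≟_ j (upTo n) + (𝟙 (does (n ℕ.≟ j)) + 0) ≡⟨ cong₂ _+_ (multiplicity-upTo j n) (+-identityʳ _) ⟩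
  𝟙 (does (j <? n)) + 𝟙 (does (n ℕ.≟ j))              ≡⟨ last (<-cmp j n) ⟩
  𝟙 (does (j <? suc n))                                ∎
  where
  open ≡-Reasoning
  last : Tri (j < n) (j ≡ n) (n < j) → 𝟙 (does (j <? n)) + 𝟙 (does (n ℕ.≟ j)) ≡ 𝟙 (does (j <? suc n))
  last (tri< j<n _ _) rewrite dec-true (j <? n) j<n | dec-false (n ℕ.≟ j) (>⇒≢ j<n)
                            | dec-true (j <? suc n) (m<n⇒m<1+n j<n) = refl
  last (tri≈ _ refl _) rewrite dec-false (j <? j) (n≮n j) | dec-true (j ℕ.≟ j) refl
                             | dec-true (j <? suc j) (n<1+n j) = refl
  last (tri> _ _ n<j) rewrite dec-false (j <? n) (<⇒≯ n<j) | dec-false (n ℕ.≟ j) (<⇒≢ n<j)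
                            | dec-false (j <? suc n) (<⇒≱ n<j ∘ ≤-pred) = refl

count-subsets-of-size : ∀ n k → ∑[ S ∈ elements (enumSubsets n) ] 𝟙 (does (k ℕ.≟ ∣ S ∣)) ≡ n C k
count-subsets-of-size zero    zero    = refl
count-subsets-of-size zero    (suc k) = refl
count-subsets-of-size (suc n) k = trans (∑-cartesianProductWith _ _∷_ (true ∷ false ∷ []) subsets) (by-size k)
  where
  subsets = elements (enumSubsets n)
  by-size : ∀ k → (∑[ S ∈ subsets ] 𝟙 (does (k ℕ.≟ suc ∣ S ∣))) + ((∑[ S ∈ subsets ] 𝟙 (does (k ℕ.≟ ∣ S ∣))) + 0)
                  ≡ suc n C k
  by-size zero    = cong₂ _+_ (∑-zero (λ _ → refl) subsets) (trans (+-identityʳ _) (count-subsets-of-size n 0))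
  by-size (suc k) = trans (cong₂ _+_ (count-subsets-of-size n k)
                                     (trans (+-identityʳ _) (count-subsets-of-size n (suc k))))
                          (nCk+nC[k+1]≡[n+1]C[k+1] n k)

∑-by-size : ∀ n (g : ℕ → ℕ) → ∑[ S ∈ elements (enumSubsets n) ] g ∣ S ∣ ≡ ∑[ k ∈ upTo (suc n) ] (n C k) * g k
∑-by-size n g = begin
  ∑[ S ∈ subsets ] g ∣ S ∣
    ≡⟨ ∑-cong (λ S → sym (trans (cong (_* g ∣ S ∣) (multiplicity-upTo (∣ S ∣) (suc n)))
                               (trans (cong (λ b → 𝟙 b * g ∣ S ∣) (dec-true (∣ S ∣ <? suc n) (s≤s (∣p∣≤n S))))
                                      (*-identityˡ (g ∣ S ∣))))) subsets ⟩
  ∑[ S ∈ subsets ] multiplicity ℕ._≟_ (∣ S ∣) (upTo (suc n)) * g (∣ S ∣)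
    ≡⟨ ∑-cong (λ S → sym (∑-select ℕ._≟_ g (∣ S ∣) (upTo (suc n)))) subsets ⟩
  ∑[ S ∈ subsets ] ∑[ k ∈ upTo (suc n) ] 𝟙 (does (k ℕ.≟ ∣ S ∣)) * g k
    ≡⟨ ∑-comm _ subsets (upTo (suc n)) ⟩
  ∑[ k ∈ upTo (suc n) ] ∑[ S ∈ subsets ] 𝟙 (does (k ℕ.≟ ∣ S ∣)) * g k
    ≡⟨ ∑-cong (λ k → trans (∑-*ʳ (g k) _ subsets) (cong (_* g k) (count-subsets-of-size n k))) (upTo (suc n)) ⟩
  ∑[ k ∈ upTo (suc n) ] (n C k) * g k ∎
  where
  open ≡-Reasoning
  subsets = elements (enumSubsets n)

-- The recurrence

comCount : ℕ → ℕ → ℕ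
comCount m n = length (Com n m)

weightedComCount : ℕ → ℕ → ℕ → ℕ
weightedComCount m χ n = ∑[ t ∈ Com n m ] χ ^ ncomp t

∑-Com : ∀ n m (f : Tuple n m → ℕ) → ∑ (Com n m) f ≡ ∑[ t ∈ allTuples n m ] 𝟙 (isComB t) * f t
∑-Com n m f = trans (∑-filter (λ t → isComB t Bool.≟ true) f (allTuples n m))
                    (∑-cong (λ t → cong (λ b → 𝟙 b * f t) (does-≟true (isComB t))) (allTuples n m))

comCount≡∑ : ∀ m n → comCount m n ≡ ∑[ t ∈ allTuples n m ] 𝟙 (isComB t)
comCount≡∑ m n = trans (length-filter (λ t → isComB t Bool.≟ true) (allTuples n m))
                       (∑-cong (λ t → cong 𝟙 (does-≟true (isComB t))) (allTuples n m))

comCount-zero : ∀ m → comCount m 0 ≡ 1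
comCount-zero m = trans (comCount≡∑ m 0) (trans (∑-cong trivial (allTuples 0 m)) (multiplicity≡1 (enumTuples 0 m) t₀))
  where
  t₀ : Tuple 0 m
  t₀ = Vec.replicate m []
  unique : ∀ {m} (t : Tuple 0 m) → t ≡ Vec.replicate m []
  unique []       = refl
  unique ([] ∷ t) = cong ([] ∷_) (unique t)
  trivial : ∀ t → 𝟙 (isComB t) ≡ 𝟙 (does (Enumeration._≟_ (enumTuples 0 m) t t₀))
  trivial t = trans (T⇒𝟙≡1 (commutingTuple⇒isComB t ((λ _ {x} → ⊥-elim (Fin.¬Fin0 x)) , (λ _ _ ()))))
                    (sym (T⇒𝟙≡1 (does⁺ (Enumeration._≟_ (enumTuples 0 m) t t₀) (unique t))))

∑-decomposed : ∀ m χ {n} (S : Subset n) →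
  ∑ (elements (enum× (enum× (enumTuples (∣ S ∣) m) (enumTuples (∣ ∁ S ∣) m)) (enumColourings χ (∣ ∁ S ∣))))
    (𝟙 ∘ Decomposition.valid′ m χ S)
  ≡ comCount m (∣ S ∣) * weightedComCount m χ (∣ ∁ S ∣)
∑-decomposed m χ S = begin
  ∑ (cartesianProduct (cartesianProduct T₁ T₂) V) (𝟙 ∘ valid′)
    ≡⟨ ∑-cartesianProductWith _ _,_ (cartesianProduct T₁ T₂) V ⟩
  ∑[ t₁₂ ∈ cartesianProduct T₁ T₂ ] ∑[ c′ ∈ V ] 𝟙 (valid′ (t₁₂ , c′))
    ≡⟨ ∑-cartesianProductWith _ _,_ T₁ T₂ ⟩
  ∑[ t₁ ∈ T₁ ] ∑[ t₂ ∈ T₂ ] ∑[ c′ ∈ V ] 𝟙 (valid′ ((t₁ , t₂) , c′))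
    ≡⟨ ∑-cong (λ t₁ → ∑-cong (colourings t₁) T₂) T₁ ⟩
  ∑[ t₁ ∈ T₁ ] ∑[ t₂ ∈ T₂ ] 𝟙 (isComB t₁) * (𝟙 (isComB t₂) * χ ^ ncomp t₂)
    ≡⟨ ∑-cong (λ t₁ → ∑-*ˡ (𝟙 (isComB t₁)) _ T₂) T₁ ⟩
  ∑[ t₁ ∈ T₁ ] 𝟙 (isComB t₁) * (∑[ t₂ ∈ T₂ ] 𝟙 (isComB t₂) * χ ^ ncomp t₂)
    ≡⟨ ∑-*ʳ _ (𝟙 ∘ isComB) T₁ ⟩
  (∑[ t₁ ∈ T₁ ] 𝟙 (isComB t₁)) * (∑[ t₂ ∈ T₂ ] 𝟙 (isComB t₂) * χ ^ ncomp t₂)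
    ≡⟨ cong₂ _*_ (comCount≡∑ m (∣ S ∣)) (∑-Com (∣ ∁ S ∣) m (λ t → χ ^ ncomp t)) ⟨
  comCount m (∣ S ∣) * weightedComCount m χ (∣ ∁ S ∣) ∎
  where
  open ≡-Reasoning
  open Decomposition m χ S using (valid′)
  open Components using (invariant?)
  T₁ = allTuples (∣ S ∣) m
  T₂ = allTuples (∣ ∁ S ∣) m
  V  = allVecs χ (∣ ∁ S ∣)
  colourings : ∀ t₁ t₂ → ∑[ c′ ∈ V ] 𝟙 (valid′ ((t₁ , t₂) , c′)) ≡ 𝟙 (isComB t₁) * (𝟙 (isComB t₂) * χ ^ ncomp t₂)
  colourings t₁ t₂ = begin
    ∑[ c′ ∈ V ] 𝟙 (isComB t₁ ∧ (isComB t₂ ∧ does (invariant? t₂ c′)))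
      ≡⟨ ∑-cong (λ c′ → trans (𝟙-∧ (isComB t₁) _) (cong (𝟙 (isComB t₁) *_) (𝟙-∧ (isComB t₂) _))) V ⟩
    ∑[ c′ ∈ V ] 𝟙 (isComB t₁) * (𝟙 (isComB t₂) * 𝟙 (does (invariant? t₂ c′)))
      ≡⟨ ∑-*ˡ (𝟙 (isComB t₁)) _ V ⟩
    𝟙 (isComB t₁) * (∑[ c′ ∈ V ] 𝟙 (isComB t₂) * 𝟙 (does (invariant? t₂ c′)))
      ≡⟨ cong (𝟙 (isComB t₁) *_) (∑-*ˡ (𝟙 (isComB t₂)) _ V) ⟩
    𝟙 (isComB t₁) * (𝟙 (isComB t₂) * (∑[ c′ ∈ V ] 𝟙 (does (invariant? t₂ c′))))
      ≡⟨ cong (λ k → 𝟙 (isComB t₁) * (𝟙 (isComB t₂) * k)) (invariant-count χ t₂) ⟨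
    𝟙 (isComB t₁) * (𝟙 (isComB t₂) * χ ^ ncomp t₂) ∎

∑-valid : ∀ m χ {n} (t : Tuple n m) (c : Vec (Fin (suc χ)) n) →
  ∑[ S ∈ elements (enumSubsets n) ] 𝟙 (Decomposition.valid m χ S (t , c)) ≡
  𝟙 (isComB t) * 𝟙 (does (Components.invariant? t c))
∑-valid m χ {n} t c = begin
  ∑[ S ∈ Ss ] 𝟙 (does (S ≟ˢ zeroSet c) ∧ (isComB t ∧ does (invariant? t c)))
    ≡⟨ ∑-cong (λ S → 𝟙-∧ (does (S ≟ˢ zeroSet c)) _) Ss ⟩
  ∑[ S ∈ Ss ] 𝟙 (does (S ≟ˢ zeroSet c)) * 𝟙 (isComB t ∧ does (invariant? t c))
    ≡⟨ ∑-*ʳ _ (λ S → 𝟙 (does (S ≟ˢ zeroSet c))) Ss ⟩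
  multiplicity _≟ˢ_ (zeroSet c) Ss * 𝟙 (isComB t ∧ does (invariant? t c))
    ≡⟨ cong (_* 𝟙 (isComB t ∧ does (invariant? t c))) (multiplicity≡1 (enumSubsets n) (zeroSet c)) ⟩
  1 * 𝟙 (isComB t ∧ does (invariant? t c))
    ≡⟨ trans (*-identityˡ _) (𝟙-∧ (isComB t) _) ⟩
  𝟙 (isComB t) * 𝟙 (does (invariant? t c)) ∎
  where
  open ≡-Reasoning
  open Components using (invariant?)
  Ss = elements (enumSubsets n)

weightedComCount-subsets : ∀ m χ n →
  weightedComCount m (suc χ) n ≡ ∑[ S ∈ elements (enumSubsets n) ] comCount m (∣ S ∣) * weightedComCount m χ (∣ ∁ S ∣)
weightedComCount-subsets m χ n = begin
  weightedComCount m (suc χ) n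
    ≡⟨ ∑-Com n m _ ⟩
  ∑[ t ∈ Ts ] 𝟙 (isComB t) * suc χ ^ ncomp t
    ≡⟨ ∑-cong (λ t → cong (𝟙 (isComB t) *_) (invariant-count (suc χ) t)) Ts ⟩
  ∑[ t ∈ Ts ] 𝟙 (isComB t) * (∑[ c ∈ Cs ] 𝟙 (does (invariant? t c)))
    ≡⟨ ∑-cong (λ t → sym (∑-*ˡ (𝟙 (isComB t)) _ Cs)) Ts ⟩
  ∑[ t ∈ Ts ] ∑[ c ∈ Cs ] 𝟙 (isComB t) * 𝟙 (does (invariant? t c))
    ≡⟨ ∑-cong (λ t → ∑-cong (λ c → sym (∑-valid m χ t c)) Cs) Ts ⟩
  ∑[ t ∈ Ts ] ∑[ c ∈ Cs ] ∑[ S ∈ Ss ] 𝟙 (valid S (t , c))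
    ≡⟨ ∑-cartesianProductWith _ _,_ Ts Cs ⟨
  ∑[ tc ∈ cartesianProduct Ts Cs ] ∑[ S ∈ Ss ] 𝟙 (valid S tc)
    ≡⟨ ∑-comm _ (cartesianProduct Ts Cs) Ss ⟩
  ∑[ S ∈ Ss ] ∑[ tc ∈ cartesianProduct Ts Cs ] 𝟙 (valid S tc)
    ≡⟨ ∑-cong (λ S → trans (Decomposition.count-decomposition m χ S) (∑-decomposed m χ S)) Ss ⟩
  ∑[ S ∈ Ss ] comCount m (∣ S ∣) * weightedComCount m χ (∣ ∁ S ∣) ∎
  where
  open ≡-Reasoning
  open Components using (invariant?)
  valid : ∀ S → Tuple n m × Vec (Fin (suc χ)) n → Bool
  valid = Decomposition.valid m χ
  Ts = allTuples n m
  Cs = allVecs (suc χ) n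
  Ss = elements (enumSubsets n)

weightedComCount-recurrence : ∀ m χ n →
  weightedComCount m (suc χ) n ≡ ∑[ k ∈ upTo (suc n) ] (n C k) * (comCount m k * weightedComCount m χ (n ∸ k))
weightedComCount-recurrence m χ n = trans (weightedComCount-subsets m χ n) (trans
  (∑-cong (λ S → cong (λ j → comCount m (∣ S ∣) * weightedComCount m χ j) (∣∁p∣≡n∸∣p∣ S)) (elements (enumSubsets n)))
  (∑-by-size n (λ k → comCount m k * weightedComCount m χ (n ∸ k))))

_/1+_ : ℕ → ℕ → ℚᵘ
a /1+ d = mkℚᵘ (ℤ.+ a) d

/1+-≃ : ∀ {a d b e} → a * suc e ≡ b * suc d → a /1+ d ≃ᵘ b /1+ e
/1+-≃ {a} {d} {b} {e} eq = *≡* (trans (sym (ℤ.pos-* a (suc e))) (trans (cong ℤ.+_ eq) (ℤ.pos-* b (suc d))))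

/1+-+ : ∀ a d b e → a /1+ d +ᵘ b /1+ e ≡ (a * suc e + b * suc d) /1+ (e + d * suc e)
/1+-+ a d b e = cong (λ i → mkℚᵘ i (e + d * suc e))
  (trans (cong₂ ℤ._+_ (sym (ℤ.pos-* a (suc e))) (sym (ℤ.pos-* b (suc d)))) (sym (ℤ.pos-+ (a * suc e) (b * suc d))))

/1+-* : ∀ a d b e → a /1+ d *ᵘ b /1+ e ≡ (a * b) /1+ (e + d * suc e)
/1+-* a d b e = cong (λ i → mkℚᵘ i (e + d * suc e)) (sym (ℤ.pos-* a b))

toℚᵘ-divFact : ∀ a k → toℚᵘ (divFact a k) ≃ᵘ a /1+ pred (k !)
toℚᵘ-divFact a k = ℚᵘ.≃-trans (ℚ.toℚᵘ-cong (ℚ./-cong {p₁ = ℤ.+ a} {{k !≢0}} refl (sym (suc-pred (k !) {{k !≢0}}))))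
                            (ℚ.toℚᵘ-fromℚᵘ (a /1+ pred (k !)))

divFact-0 : ∀ k → divFact 0 k ≡ 0ℚ
divFact-0 k = ℚ.0/n≡0 (k !) {{k !≢0}}

divFact-+ : ∀ a b k → divFact (a + b) k ≡ divFact a k +ℚ divFact b k
divFact-+ a b k = ℚ.toℚᵘ-injective (begin-equality
  toℚᵘ (divFact (a + b) k)                 ≃⟨ toℚᵘ-divFact (a + b) k ⟩
  (a + b) /1+ d                            ≃⟨ /1+-≃ (cross a b d) ⟩
  (a * suc d + b * suc d) /1+ (d + d * suc d) ≡⟨ /1+-+ a d b d ⟨
  a /1+ d +ᵘ b /1+ d                       ≃⟨ ℚᵘ.+-cong (toℚᵘ-divFact a k) (toℚᵘ-divFact b k) ⟨
  toℚᵘ (divFact a k) +ᵘ toℚᵘ (divFact b k) ≃⟨ ℚ.toℚᵘ-homo-+ (divFact a k) (divFact b k) ⟨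
  toℚᵘ (divFact a k +ℚ divFact b k)        ∎)
  where
  open ℚᵘ.≤-Reasoning
  d = pred (k !)
  cross : ∀ a b d → (a + b) * suc (d + d * suc d) ≡ (a * suc d + b * suc d) * suc d
  cross = solve-∀

divFact-∑ : ∀ (f : A → ℕ) xs k → divFact (∑ xs f) k ≡ sumℚ (map (λ x → divFact (f x) k) xs)
divFact-∑ f []       k = divFact-0 k
divFact-∑ f (x ∷ xs) k = trans (divFact-+ (f x) (∑ xs f) k) (cong (divFact (f x) k +ℚ_) (divFact-∑ f xs k))

n!≡nCk*k!*[n∸k]! : ∀ {n k} → k ≤ n → n ! ≡ (n C k) * (k ! * (n ∸ k) !)
n!≡nCk*k!*[n∸k]! {n} {k} k≤n = sym (trans (cong (_* (k ! * (n ∸ k) !)) (nCk≡n!/k![n-k]! k≤n))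
                                          (m/n*n≡m {{k !* (n ∸ k) !≢0}} (k![n∸k]!∣n! k≤n)))

divFact-binomial : ∀ {n k} → k ≤ n → ∀ a b → divFact ((n C k) * (a * b)) n ≡ divFact a k *ℚ divFact b (n ∸ k)
divFact-binomial {n} {k} k≤n a b = ℚ.toℚᵘ-injective (let open ℚᵘ.≤-Reasoning in begin-equality
  toℚᵘ (divFact ((n C k) * (a * b)) n)        ≃⟨ toℚᵘ-divFact ((n C k) * (a * b)) n ⟩
  ((n C k) * (a * b)) /1+ d                   ≃⟨ /1+-≃ cross ⟩
  (a * b) /1+ (e + dₖ * suc e)                ≡⟨ /1+-* a dₖ b e ⟨
  a /1+ dₖ *ᵘ b /1+ e                         ≃⟨ ℚᵘ.*-cong (toℚᵘ-divFact a k) (toℚᵘ-divFact b (n ∸ k)) ⟨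
  toℚᵘ (divFact a k) *ᵘ toℚᵘ (divFact b (n ∸ k)) ≃⟨ ℚ.toℚᵘ-homo-* (divFact a k) (divFact b (n ∸ k)) ⟨
  toℚᵘ (divFact a k *ℚ divFact b (n ∸ k))     ∎)
  where
  d  = pred (n !)
  dₖ = pred (k !)
  e  = pred ((n ∸ k) !)
  cross : (n C k) * (a * b) * suc (e + dₖ * suc e) ≡ a * b * suc d
  cross = begin
    (n C k) * (a * b) * (suc dₖ * suc e)      ≡⟨ cong ((n C k) * (a * b) *_) (cong₂ _*_ (suc-pred (k !) {{k !≢0}})
                                                                              (suc-pred ((n ∸ k) !) {{(n ∸ k) !≢0}})) ⟩
    (n C k) * (a * b) * (k ! * (n ∸ k) !)     ≡⟨ rearrange (n C k) (a * b) (k ! * (n ∸ k) !) ⟩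
    a * b * ((n C k) * (k ! * (n ∸ k) !))     ≡⟨ cong (a * b *_) (n!≡nCk*k!*[n∸k]! k≤n) ⟨
    a * b * n !                               ≡⟨ cong (a * b *_) (suc-pred (n !) {{n !≢0}}) ⟨
    a * b * suc d                             ∎
    where
    open ≡-Reasoning
    rearrange : ∀ c x y → c * x * y ≡ x * (c * y)
    rearrange = solve-∀

lemma2 : (χ m : ℕ) → 1 ≤ m → (n : ℕ) → lhsSeries χ m n ≡ powS (comSeries m) χ n
lemma2 zero m _ zero    = cong (λ a → divFact a 0) (trans (sym (length≡∑1 (Com 0 m))) (comCount-zero m))
lemma2 zero m _ (suc n) = trans (cong (λ a → divFact a (suc n)) (∑-zero (λ t → invariant-count 0 t) (Com (suc n) m)))
                                (divFact-0 (suc n))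
lemma2 (suc χ) m 1≤m n = begin
  divFact (weightedComCount m (suc χ) n) n
    ≡⟨ cong (λ a → divFact a n) (weightedComCount-recurrence m χ n) ⟩
  divFact (∑[ k ∈ upTo (suc n) ] (n C k) * (comCount m k * weightedComCount m χ (n ∸ k))) n
    ≡⟨ divFact-∑ (λ k → (n C k) * (comCount m k * weightedComCount m χ (n ∸ k))) (upTo (suc n)) n ⟩
  sumℚ (map (λ k → divFact ((n C k) * (comCount m k * weightedComCount m χ (n ∸ k))) n) (upTo (suc n)))
    ≡⟨ cong sumℚ (List.map-cong-local (All.tabulate λ {k} k∈ →
         trans (divFact-binomial (≤-pred (∈-upTo⁻ k∈)) (comCount m k) (weightedComCount m χ (n ∸ k)))
               (cong (comSeries m k *ℚ_) (lemma2 χ m 1≤m (n ∸ k))))) ⟩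
  powS (comSeries m) (suc χ) n ∎
  where open ≡-Reasoning
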